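{- Let $\tau$ be a vocabulary containing constants $0,\max$ and a binary relation symbol $S$ (the successor relation), and let $R\notin\tau$ be a $k$-ary relation symbol. Then for every $\tau\cup\{R\}$-sentence $\psi$ of $\mathrm{SO}\exists\text{ -Horn}$ in which $R$ appears only negatively, there is a $\tau$-formula $\varphi$ of $\mathrm{BD}\text{ -Horn}$ with free variables $z_1,\dots,z_k$ such that for all $\tau$-structures $\mathfrak A$ and all teams $X\neq\emptyset$ with domain $\{z_1,\dots,z_k\}$: $\mathfrak A\models_X\varphi$ iff $(\mathfrak A,\mathrm{rel}(X))\models\psi$.
   Context: Team semantics: a team $X$ is a set of assignments into $A$ with a common domain; for domain $\{z_1,\dots,z_k\}$, $\mathrm{rel}(X)=\{(s(z_1),\dots,s(z_k)):s\in X\}$. $\mathfrak A\models_X$ a first-order literal iff all $s\in X$ satisfy it; $\mathfrak A\models_X=\!(t_1,\dots,t_n)$ iff any $s,s'\in X$ agreeing on $t_1,\dots,t_{n-1}$ agree on $t_n$; $\mathfrak A\models_X\neg=\!(\dots)$ iff $X=\emptyset$; $\wedge$ componentwise; $\mathfrak A\models_X\chi_1\vee\chi_2$ iff $X=Y\cup Z$ with $\mathfrak A\models_Y\chi_1$, $\mathfrak A\models_Z\chi_2$; $\mathfrak A\models_X\exists x\chi$ iff $\mathfrak A\models_{\{s(F(s)/x):s\in X\}}\chi$ for some $F:X\to A$; $\mathfrak A\models_X\forall x\chi$ iff $\mathfrak A\models_{\{s(a/x):s\in X,a\in A\}}\chi$. A clause is a disjunction of atomic and negated atomic first-order formulae (including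 $\bot,\top$). A $\mathrm{BD}\text{ -Horn}$ formula is $\forall\overline x\exists y_1\dots\exists y_n(\bigwedge_i=\!(\overline w_i,y_i)\wedge\bigwedge_jC_j)$ with $y_i$ pairwise distinct, clauses $C_j$ each containing at most one positive atomic formula with an occurrence of an existentially quantified variable, and existentially quantified variables occurring only in atoms $y_i=0$ or $y_i=y_j$ (free variables may occur). An $\mathrm{SO}\exists\text{ -Horn}$ sentence is $\exists P_1\dots\exists P_m\forall\overline x\bigwedge_jC_j$ with each clause $C_j$ containing at most one positive occurrence of a quantified predicate $P_i$; $R$ appears only negatively if every occurrence of $R$ is in a negated atom. -}

module Defs where

open import Data.Nat using (ℕ; zero; suc; _+_; _≤_)
open import Data.Fin using (Fin; _≟_; _↑ˡ_; _↑ʳ_)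
open import Data.Vec using (Vec; []; _∷_; lookup)
import Data.Vec as V
open import Data.Vec.Relation.Unary.Any using () renaming (Any to VAny)
open import Data.Bool using (Bool; true; false; _∧_; _∨_; not; T)
open import Data.List using (List; []; _∷_; length)
import Data.List as L
open import Data.List.Relation.Unary.All using (All)
open import Data.Product using (Σ; _×_; _,_)
open import Data.Sum using (_⊎_)
open import Data.Empty using (⊥)
open import Relation.Nullary using (¬_)
open import Relation.Nullary.Decidable using (⌊_⌋)
open import Relation.Binary.PropositionalEquality using (_≡_)

record Vocabulary : Set₁ where
  field
    Const    : Set
    Rel      : Set
    arity    : Rel → ℕ
    c0       : Const
    cmax     : Const
    S        : Rel
    S-binary : arity S ≡ 2
open Vocabulary public

record Structure (τ : Vocabulary) : Set where
  field
    size   : ℕ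
    constI : Const τ → Fin size
    relI   : (r : Rel τ) → Vec (Fin size) (arity τ r) → Bool
open Structure public

-- First-order syntax over a set C of constants and a set Sym of relation
-- symbols with arities; variables are de Bruijn indices Fin m
-- (index 0 = most recently quantified variable).

data Term (C : Set) (m : ℕ) : Set where
  var : Fin m → Term C m
  con : C → Term C m

data Atom (C Sym : Set) (ar : Sym → ℕ) (m : ℕ) : Set where
  rel  : (r : Sym) → Vec (Term C m) (ar r) → Atom C Sym ar m
  _≐_  : Term C m → Term C m → Atom C Sym ar m
  bot  : Atom C Sym ar m
  top  : Atom C Sym ar m

data Literal (C Sym : Set) (ar : Sym → ℕ) (m : ℕ) : Set where
  pos : Atom C Sym ar m → Literal C Sym ar m
  neg : Atom C Sym ar m → Literal C Sym ar m

-- a clause: a (finite) disjunction of literals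
Clause : (C Sym : Set) (ar : Sym → ℕ) (m : ℕ) → Set
Clause C Sym ar m = List (Literal C Sym ar m)

module Eval {C Sym : Set} {ar : Sym → ℕ} {n : ℕ}
            (cI : C → Fin n) (rI : (r : Sym) → Vec (Fin n) (ar r) → Bool) where

  evalT : ∀ {m} → Vec (Fin n) m → Term C m → Fin n
  evalT s (var i) = lookup s i
  evalT s (con c) = cI c

  evalA : ∀ {m} → Vec (Fin n) m → Atom C Sym ar m → Bool
  evalA s (rel r ts) = rI r (V.map (evalT s) ts)
  evalA s (t ≐ u)    = ⌊ evalT s t ≟ evalT s u ⌋
  evalA s bot        = false
  evalA s top        = true

  evalL : ∀ {m} → Vec (Fin n) m → Literal C Sym ar m → Bool
  evalL s (pos a) = evalA s a
  evalL s (neg a) = not (evalA s a)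

  evalC : ∀ {m} → Vec (Fin n) m → Clause C Sym ar m → Bool
  evalC s []      = false
  evalC s (l ∷ c) = evalL s l ∨ evalC s c

FOLit : Vocabulary → ℕ → Set
FOLit τ m = Literal (Const τ) (Rel τ) (arity τ) m

data DFm (τ : Vocabulary) : ℕ → Set where
  lit   : ∀ {m} → FOLit τ m → DFm τ m
  dep   : ∀ {m} → List (Term (Const τ) m) → Term (Const τ) m → DFm τ m
  ndep  : ∀ {m} → List (Term (Const τ) m) → Term (Const τ) m → DFm τ m
  _∧'_  : ∀ {m} → DFm τ m → DFm τ m → DFm τ m
  _∨'_  : ∀ {m} → DFm τ m → DFm τ m → DFm τ m
  ∃'    : ∀ {m} → DFm τ (suc m) → DFm τ m
  ∀'    : ∀ {m} → DFm τ (suc m) → DFm τ m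

Team : ℕ → ℕ → Set
Team n m = Vec (Fin n) m → Bool

module TeamSem {τ : Vocabulary} (𝔄 : Structure τ) where
  open Eval {Const τ} {Rel τ} {arity τ} {size 𝔄} (constI 𝔄) (relI 𝔄)

  A : Set
  A = Fin (size 𝔄)

  -- X(F/x) = { s(F(s)/x) : s ∈ X }   (new variable gets index 0)
  supplement : ∀ {m} → Team (size 𝔄) m → (Vec A m → A) → Team (size 𝔄) (suc m)
  supplement X F (a ∷ s) = X s ∧ ⌊ a ≟ F s ⌋

  duplicate : ∀ {m} → Team (size 𝔄) m → Team (size 𝔄) (suc m)
  duplicate X (a ∷ s) = X s

  infix 4 _⊨_
  _⊨_ : ∀ {m} → Team (size 𝔄) m → DFm τ m → Set
  X ⊨ lit l      = ∀ s → T (X s) → T (evalL s l)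
  X ⊨ dep ws t   = ∀ s s' → T (X s) → T (X s') →
                     L.map (evalT s) ws ≡ L.map (evalT s') ws → evalT s t ≡ evalT s' t
  X ⊨ ndep ws t  = ∀ s → ¬ T (X s)
  X ⊨ (φ ∧' ψ)   = (X ⊨ φ) × (X ⊨ ψ)
  X ⊨ (φ ∨' ψ)   = Σ (Team (size 𝔄) _) λ Y → Σ (Team (size 𝔄) _) λ Z →
                     (∀ s → X s ≡ (Y s ∨ Z s)) × (Y ⊨ φ) × (Z ⊨ ψ)
  X ⊨ ∃' φ       = Σ (Vec A _ → A) λ F → supplement X F ⊨ φ
  X ⊨ ∀' φ       = duplicate X ⊨ φ

∀* : ∀ {τ m} (p : ℕ) → DFm τ (p + m) → DFm τ m
∀* zero    φ = φ
∀* (suc p) φ = ∀* p (∀' φ)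

∃* : ∀ {τ m} (p : ℕ) → DFm τ (p + m) → DFm τ m
∃* zero    φ = φ
∃* (suc p) φ = ∃* p (∃' φ)

⋀ : ∀ {τ m} → List (DFm τ m) → DFm τ m
⋀ []       = lit (pos top)
⋀ (φ ∷ []) = φ
⋀ (φ ∷ ψs) = φ ∧' ⋀ ψs

clauseFm : ∀ {τ m} → List (FOLit τ m) → DFm τ m
clauseFm []       = lit (pos bot)
clauseFm (l ∷ []) = lit l
clauseFm (l ∷ c)  = lit l ∨' clauseFm c

-- BD-Horn formulas with k free variables z₁…zₖ (indices of Fin k):
--   ∀x₁…xₚ ∃y₁…yₙ ( ⋀ᵢ =(w̄ᵢ,yᵢ) ∧ ⋀ⱼ Cⱼ )
-- The body lives in context n + (p + k): indices i ↑ˡ _ are the yᵢ,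
-- indices n ↑ʳ j are the universally quantified / free variables.

module BD (τ : Vocabulary) (n q : ℕ) where
  FTerm : Set
  FTerm = Term (Const τ) (n + q)
  FAtom : Set
  FAtom = Atom (Const τ) (Rel τ) (arity τ) (n + q)

  y : Fin n → FTerm
  y i = var (i ↑ˡ q)

  IsEx : FTerm → Set
  IsEx t = Σ (Fin n) λ i → t ≡ y i

  ExOcc : FAtom → Set
  ExOcc (rel r ts) = VAny IsEx ts
  ExOcc (t ≐ u)    = IsEx t ⊎ IsEx u
  ExOcc bot        = ⊥
  ExOcc top        = ⊥

  data ExAtom : FAtom → Set where
    y=0 : ∀ i   → ExAtom (y i ≐ con (c0 τ))
    y=y : ∀ i j → ExAtom (y i ≐ y j)

  atomOf : FOLit τ (n + q) → FAtom
  atomOf (pos a) = a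
  atomOf (neg a) = a

  PosEx : FOLit τ (n + q) → Set
  PosEx l = Σ FAtom λ a → (l ≡ pos a) × ExOcc a

  record BDClause : Set where
    field
      lits    : List (FOLit τ (n + q))
      onlyEx  : All (λ l → ExOcc (atomOf l) → ExAtom (atomOf l)) lits
      horn    : ∀ (i j : Fin (length lits)) →
                  PosEx (L.lookup lits i) → PosEx (L.lookup lits j) → i ≡ j

record BDHorn (τ : Vocabulary) (k : ℕ) : Set where
  field
    p       : ℕ
    n       : ℕ
    deps    : Fin n → List (Fin (p + k))
    clauses : List (BD.BDClause τ n (p + k))

  body : DFm τ (n + (p + k))
  body = ⋀ (L.map depAtom (L.allFin n)) ∧' ⋀ (L.map (λ C → clauseFm (BD.BDClause.lits C)) clauses)
    where
      depAtom : Fin n → DFm τ (n + (p + k))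
      depAtom i = dep (L.map (λ j → var (n ↑ʳ j)) (deps i)) (var (i ↑ˡ (p + k)))

  formula : DFm τ k
  formula = ∀* p (∃* n body)

-- SO∃-Horn sentences over τ ∪ {R} (R k-ary, R ∉ τ):
--   ∃P₁…∃Pₘ ∀x₁…xₚ ⋀ⱼ Cⱼ

data SOSym (τ : Vocabulary) (mP : ℕ) : Set where
  τrel : Rel τ → SOSym τ mP
  Rsym : SOSym τ mP
  Psym : Fin mP → SOSym τ mP

soArity : (τ : Vocabulary) (k mP : ℕ) (ars : Fin mP → ℕ) → SOSym τ mP → ℕ
soArity τ k mP ars (τrel r) = arity τ r
soArity τ k mP ars Rsym     = k
soArity τ k mP ars (Psym i) = ars i

record SOHorn (τ : Vocabulary) (k : ℕ) : Set where
  field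
    mP      : ℕ
    ars     : Fin mP → ℕ
    p       : ℕ
  SLit : Set
  SLit = Literal (Const τ) (SOSym τ mP) (soArity τ k mP ars) p
  PosP : SLit → Set
  PosP l = Σ (Fin mP) λ i → Σ (Vec (Term (Const τ) p) (ars i)) λ ts → l ≡ pos (rel (Psym i) ts)
  field
    clauses : List (List SLit)
    horn    : All (λ c → ∀ (i j : Fin (length c)) →
                     PosP (L.lookup c i) → PosP (L.lookup c j) → i ≡ j) clauses

OnlyNegR : ∀ {τ k} → SOHorn τ k → Set
OnlyNegR {τ} {k} ψ = All (All (λ l → ∀ ts → ¬ (l ≡ pos (rel Rsym ts)))) (SOHorn.clauses ψ)

_,_⊨SO_ : ∀ {τ k} (𝔄 : Structure τ) → (Vec (Fin (size 𝔄)) k → Bool) → SOHorn τ k → Set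
_,_⊨SO_ {τ} {k} 𝔄 Rrel ψ =
  Σ ((i : Fin mP) → Vec (Fin (size 𝔄)) (ars i) → Bool) λ Ps →
    ∀ (xs : Vec (Fin (size 𝔄)) p) →
      All (λ c → T (Eval.evalC (constI 𝔄) (relI' Ps) xs c)) clauses
  where
    open SOHorn ψ
    relI' : ((i : Fin mP) → Vec (Fin (size 𝔄)) (ars i) → Bool) →
            (r : SOSym τ mP) → Vec (Fin (size 𝔄)) (soArity τ k mP ars r) → Bool
    relI' Ps (τrel r) = relI 𝔄 r
    relI' Ps Rsym     = Rrel
    relI' Ps (Psym i) = Ps i

module Submission where

-- The truth value of an atom P(ā) (P one of the
-- quantified predicates, or R) is coded by an existential variable y
-- being 0, where y depends on a block ū of universally quantified
-- variables holding ā.  Every literal position of ψ gets its own block,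
-- and consistency clauses force blocks with equal contents to code equal
-- truth values; a clause "ū = z̄ → y = 0" makes every z̄ of the team coded
-- as true for R.  Each clause of ψ is guarded by an equality g₁ = g₂ of
-- two universal variables, so it is only enforced in structures with at
-- least two elements; one-element structures are handled by separate
-- clauses saying that some choice of truth values for the Pᵢ satisfies ψ.

open import Defs
open import Data.Nat using (ℕ; zero; suc; _+_; _*_; _≤_; s≤s)
open import Data.Nat.Properties using (+-identityʳ; +-suc; m+n≤o⇒m≤o; m≤m+n; m≤n+m; ≤-trans)
open import Data.Fin using (Fin; zero; suc; toℕ; _↑ˡ_; _↑ʳ_; _≟_; combine; remQuot; splitAt)
import Data.Fin.Properties as FinP
open import Data.Vec using (Vec; []; _∷_; _++_; lookup; tabulate; replicate)
import Data.Vec as V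
import Data.Vec.Properties as VecP
open import Data.Vec.Relation.Unary.Any using (here; there) renaming (Any to AnyV)
open import Data.Bool using (Bool; true; false; T; not; _∧_; _∨_; if_then_else_)
open import Data.Bool.Properties using (T-∧; T-∨; T-≡; ∨-assoc)
open import Data.List using (List; []; _∷_; length)
import Data.List as L
import Data.List.Properties as ListP
open import Data.List.Relation.Unary.All using (All; []; _∷_)
import Data.List.Relation.Unary.All as All
import Data.List.Relation.Unary.All.Properties as AllP
open import Data.List.Membership.Propositional using (_∈_)
open import Data.List.Membership.Propositional.Properties using (∈-map⁺; ∈-concat⁺′; ∈-allFin)
import Data.List.Relation.Unary.Any as AnyL
import Data.List.Relation.Unary.Any.Properties as AnyP
open import Data.Product using (Σ; _×_; _,_; proj₁; proj₂)
open import Data.Sum using (_⊎_; inj₁; inj₂; [_,_]; [_,_]′)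
open import Data.Empty using (⊥; ⊥-elim)
open import Data.Unit using (tt; ⊤)
open import Relation.Nullary using (¬_; yes; no; ¬?)
open import Relation.Nullary.Decidable using (⌊_⌋; toWitness; fromWitness; toWitnessFalse; fromWitnessFalse; T?; decidable-stable)
open import Relation.Binary.PropositionalEquality using (_≡_; refl; sym; trans; cong; cong₂; subst; module ≡-Reasoning)
open import Function.Bundles using (_⇔_; mk⇔; Equivalence)
open import Function.Base using (_∘_)

open Equivalence using (to; from)

bool-ext : ∀ {a b : Bool} → (T a → T b) → (T b → T a) → a ≡ b
bool-ext {false} {false} _ _ = refl
bool-ext {false} {true}  _ g = ⊥-elim (g tt)
bool-ext {true}  {false} f _ = ⊥-elim (f tt)
bool-ext {true}  {true}  _ _ = refl

T-not : ∀ {b} → ¬ T b → T (not b)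
T-not {false} _ = tt
T-not {true}  n = n tt

T-not⁻ : ∀ {b} → T (not b) → ¬ T b
T-not⁻ {false} _ ()

∨-false : ∀ {b} → T (b ∨ false) ⇔ T b
∨-false {b} = mk⇔ (λ t → [ (λ t → t) , (λ ()) ] (to (T-∨ {b} {false}) t)) (λ t → from (T-∨ {b}) (inj₁ t))

T-or-not : ∀ b → T b ⊎ T (not b)
T-or-not true  = inj₁ tt
T-or-not false = inj₂ tt

take-++ : ∀ {A : Set} {m n} (xs : Vec A m) (ys : Vec A n) → V.take m (xs ++ ys) ≡ xs
take-++ {m = m} xs ys = VecP.++-injectiveˡ (V.take m (xs ++ ys)) xs (VecP.take++drop≡id m (xs ++ ys))

drop-++ : ∀ {A : Set} {m n} (xs : Vec A m) (ys : Vec A n) → V.drop m (xs ++ ys) ≡ ys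
drop-++ {m = m} xs ys = VecP.++-injectiveʳ (V.take m (xs ++ ys)) xs (VecP.take++drop≡id m (xs ++ ys))

head∷tail : ∀ {A : Set} {n} (v : Vec A (suc n)) → V.head v ∷ V.tail v ≡ v
head∷tail (x ∷ v) = refl

vec-ext : ∀ {A : Set} {n} {xs ys : Vec A n} → (∀ j → lookup xs j ≡ lookup ys j) → xs ≡ ys
vec-ext {xs = xs} {ys} h =
  trans (sym (VecP.tabulate∘lookup xs)) (trans (VecP.tabulate-cong h) (VecP.tabulate∘lookup ys))

tabulate-injective : ∀ {B : Set} n (f g : Fin n → B) → L.tabulate f ≡ L.tabulate g → ∀ j → f j ≡ g j
tabulate-injective (suc n) f g e zero    = ListP.∷-injectiveˡ e
tabulate-injective (suc n) f g e (suc j) = tabulate-injective n (λ j → f (suc j)) (λ j → g (suc j)) (ListP.∷-injectiveʳ e) j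

All-lookup : ∀ {B : Set} {P : B → Set} {xs : List B} → All P xs → ∀ i → P (L.lookup xs i)
All-lookup (p ∷ ps) zero    = p
All-lookup (p ∷ ps) (suc i) = All-lookup ps i

sumFin : ∀ n → (Fin n → ℕ) → ℕ
sumFin zero    f = 0
sumFin (suc n) f = f zero + sumFin n (λ i → f (suc i))

summand≤sumFin : ∀ n (f : Fin n → ℕ) i → f i ≤ sumFin n f
summand≤sumFin (suc n) f zero    = m≤m+n (f zero) _
summand≤sumFin (suc n) f (suc i) = ≤-trans (summand≤sumFin n (λ i → f (suc i)) i) (m≤n+m _ (f zero))

clamp : ∀ L → ℕ → Fin (suc L)
clamp L       zero    = zero
clamp zero    (suc n) = zero
clamp (suc L) (suc n) = suc (clamp L n)

clamp-toℕ : ∀ L n → n ≤ L → toℕ (clamp L n) ≡ n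
clamp-toℕ L       zero    _         = refl
clamp-toℕ (suc L) (suc n) (s≤s n≤L) = cong suc (clamp-toℕ L n n≤L)

All-swap : ∀ {B C : Set} {P : C → B → Set} (xs : List B) → (∀ a → All (P a) xs) → All (λ x → ∀ a → P a x) xs
All-swap []       h = []
All-swap (x ∷ xs) h = (λ a → All.head (h a)) ∷ All-swap xs (λ a → All.tail (h a))

allVecs : ∀ {B : Set} → List B → (n : ℕ) → List (Vec B n)
allVecs xs zero    = [] ∷ []
allVecs xs (suc n) = L.concatMap (λ x → L.map (x ∷_) (allVecs xs n)) xs

allVecs-complete : ∀ {B : Set} (xs : List B) n (u : Vec B n) → (∀ j → lookup u j ∈ xs) → u ∈ allVecs xs n
allVecs-complete xs zero    []      h = AnyL.here refl
allVecs-complete xs (suc n) (x ∷ u) h =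
  ∈-concat⁺′ (∈-map⁺ (x ∷_) (allVecs-complete xs n u (λ j → h (suc j)))) (∈-map⁺ _ (h zero))

data AtMostOne {B : Set} (P : B → Set) : List B → Set where
  []   : AtMostOne P []
  skip : ∀ {x xs} → ¬ P x → AtMostOne P xs → AtMostOne P (x ∷ xs)
  this : ∀ {x xs} → All (λ y → ¬ P y) xs → AtMostOne P (x ∷ xs)

module _ {B : Set} {P : B → Set} where

  none→AtMostOne : ∀ {xs} → All (λ y → ¬ P y) xs → AtMostOne P xs
  none→AtMostOne []       = []
  none→AtMostOne (n ∷ ns) = skip n (none→AtMostOne ns)

  AtMostOne-++ˡ : ∀ {xs ys} → All (λ y → ¬ P y) xs → AtMostOne P ys → AtMostOne P (xs L.++ ys)
  AtMostOne-++ˡ []       a = a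
  AtMostOne-++ˡ (n ∷ ns) a = skip n (AtMostOne-++ˡ ns a)

  AtMostOne-++ʳ : ∀ {xs ys} → AtMostOne P xs → All (λ y → ¬ P y) ys → AtMostOne P (xs L.++ ys)
  AtMostOne-++ʳ []          ns = none→AtMostOne ns
  AtMostOne-++ʳ (skip n a)  ns = skip n (AtMostOne-++ʳ a ns)
  AtMostOne-++ʳ (this ns')  ns = this (AllP.++⁺ ns' ns)

  AtMostOne⇒unique : ∀ {xs} → AtMostOne P xs → ∀ i j → P (L.lookup xs i) → P (L.lookup xs j) → i ≡ j
  AtMostOne⇒unique (skip n a) zero    j       pi pj = ⊥-elim (n pi)
  AtMostOne⇒unique (skip n a) (suc i) zero    pi pj = ⊥-elim (n pj)
  AtMostOne⇒unique (skip n a) (suc i) (suc j) pi pj = cong suc (AtMostOne⇒unique a i j pi pj)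
  AtMostOne⇒unique (this ns)  zero    zero    pi pj = refl
  AtMostOne⇒unique (this ns)  zero    (suc j) pi pj = ⊥-elim (All-lookup ns j pj)
  AtMostOne⇒unique (this ns)  (suc i) j       pi pj = ⊥-elim (All-lookup ns i pi)

  unique⇒AtMostOne : (∀ x → P x ⊎ ¬ P x) → ∀ xs →
                     (∀ i j → P (L.lookup xs i) → P (L.lookup xs j) → i ≡ j) → AtMostOne P xs
  unique⇒AtMostOne dec []       h = []
  unique⇒AtMostOne dec (x ∷ xs) h with dec x
  ... | inj₂ np = skip np (unique⇒AtMostOne dec xs (λ i j pi pj → FinP.suc-injective (h (suc i) (suc j) pi pj)))
  ... | inj₁ px = this (none xs (λ j pj → FinP.0≢1+n (h zero (suc j) px pj)))
    where
    none : ∀ ys → (∀ (j : Fin (length ys)) → P (L.lookup ys j) → ⊥) → All (λ y → ¬ P y) ys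
    none []       f = []
    none (y ∷ ys) f = f zero ∷ none ys (λ j → f (suc j))

-- Section 1.  Team semantics and the Skolem normal form of BD-Horn formulas

module TeamFacts {τ : Vocabulary} (𝔄 : Structure τ) where
  open TeamSem 𝔄
  open Eval {Const τ} {Rel τ} {arity τ} {size 𝔄} (constI 𝔄) (relI 𝔄)

  ⊨-cong : ∀ {m} (φ : DFm τ m) {X Y : Team (size 𝔄) m} → (∀ s → X s ≡ Y s) → X ⊨ φ → Y ⊨ φ
  ⊨-cong (lit l)     e h s y = h s (subst T (sym (e s)) y)
  ⊨-cong (dep ws t)  e h s s' y y' = h s s' (subst T (sym (e s)) y) (subst T (sym (e s')) y')
  ⊨-cong (ndep ws t) e h s y = h s (subst T (sym (e s)) y)
  ⊨-cong (φ ∧' ψ)    e (h₁ , h₂) = ⊨-cong φ e h₁ , ⊨-cong ψ e h₂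
  ⊨-cong (φ ∨' ψ)    e (Y' , Z' , split , h₁ , h₂) = Y' , Z' , (λ s → trans (sym (e s)) (split s)) , h₁ , h₂
  ⊨-cong (∃' φ)      e (F , h) = F , ⊨-cong φ (λ { (a ∷ s) → cong (_∧ ⌊ a ≟ F s ⌋) (e s) }) h
  ⊨-cong (∀' φ)      e h = ⊨-cong φ (λ { (a ∷ s) → e s }) h

  _≋_ : ∀ {m} → Team (size 𝔄) m → Team (size 𝔄) m → Set
  X ≋ Y = ∀ s → (T (X s) → T (Y s)) × (T (Y s) → T (X s))

  ⊨-≋ : ∀ {m} (φ : DFm τ m) {X Y : Team (size 𝔄) m} → X ≋ Y → X ⊨ φ → Y ⊨ φ
  ⊨-≋ φ e = ⊨-cong φ (λ s → bool-ext (proj₁ (e s)) (proj₂ (e s)))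

  ≋-sym : ∀ {m} {X Y : Team (size 𝔄) m} → X ≋ Y → Y ≋ X
  ≋-sym e s = proj₂ (e s) , proj₁ (e s)

  Dup : ∀ p {m} → Team (size 𝔄) m → Team (size 𝔄) (p + m)
  Dup p X v = X (V.drop p v)

  ∀*-sem : ∀ p {m} (φ : DFm τ (p + m)) (X : Team (size 𝔄) m) → (X ⊨ ∀* p φ) ⇔ (Dup p X ⊨ φ)
  ∀*-sem zero    φ X = mk⇔ (λ h → h) (λ h → h)
  ∀*-sem (suc p) φ X = mk⇔
    (λ h → ⊨-cong φ (λ { (a ∷ v) → refl }) (to (∀*-sem p (∀' φ) X) h))
    (λ h → from (∀*-sem p (∀' φ) X) (⊨-cong φ (λ { (a ∷ v) → refl }) h))

  Ext : ∀ n {m} → Team (size 𝔄) m → (Vec A m → Vec A n) → Team (size 𝔄) (n + m)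
  Ext n X G v = X (V.drop n v) ∧ ⌊ VecP.≡-dec _≟_ (V.take n v) (G (V.drop n v)) ⌋

  Ext⁻ : ∀ n {m} {X : Team (size 𝔄) m} {G : Vec A m → Vec A n} {v} →
         T (Ext n X G v) → Σ (Vec A m) λ w → T (X w) × v ≡ G w ++ w
  Ext⁻ n {v = v} t with to T-∧ t
  ... | x , e = V.drop n v , x ,
                trans (sym (VecP.take++drop≡id n v)) (cong (_++ V.drop n v) (toWitness e))

  Ext⁺ : ∀ n {m} {X : Team (size 𝔄) m} {G : Vec A m → Vec A n} {w} → T (X w) → T (Ext n X G (G w ++ w))
  Ext⁺ n {G = G} {w} x rewrite drop-++ (G w) w | take-++ (G w) w = from T-∧ (x , fromWitness refl)

  supplement-Ext : ∀ n {m} (X : Team (size 𝔄) m) (G : Vec A m → Vec A n) (F : Vec A (n + m) → A)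
                   (G' : Vec A m → Vec A (suc n)) → (∀ w → G' w ≡ F (G w ++ w) ∷ G w) →
                   supplement (Ext n X G) F ≋ Ext (suc n) X G'
  supplement-Ext n X G F G' eq (a ∷ v) = forth , back
    where
    forth : T (supplement (Ext n X G) F (a ∷ v)) → T (Ext (suc n) X G' (a ∷ v))
    forth t with to T-∧ t
    ... | te , ta with Ext⁻ n {X = X} {G} {v} te
    ... | w , x , refl = subst (λ u → T (Ext (suc n) X G' u))
                           (trans (cong (_++ w) (eq w)) (cong (_∷ (G w ++ w)) (sym (toWitness ta))))
                           (Ext⁺ (suc n) {X = X} {G'} {w} x)
    back : T (Ext (suc n) X G' (a ∷ v)) → T (supplement (Ext n X G) F (a ∷ v))
    back t with Ext⁻ (suc n) {X = X} {G'} {a ∷ v} t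
    ... | w , x , e with trans e (cong (_++ w) (eq w))
    ... | refl = from T-∧ (Ext⁺ n {X = X} {G} {w} x , fromWitness refl)

  ∃*-sem : ∀ n {m} (φ : DFm τ (n + m)) (X : Team (size 𝔄) m) →
           (X ⊨ ∃* n φ) ⇔ Σ (Vec A m → Vec A n) (λ G → Ext n X G ⊨ φ)
  ∃*-sem zero {m} φ X = mk⇔ (λ h → (λ _ → []) , ⊨-≋ φ (λ s → into (λ _ → []) s , out (λ _ → []) s) h)
                            (λ { (G , h) → ⊨-≋ φ (λ s → out G s , into G s) h })
    where
    into : ∀ (G : Vec A m → Vec A 0) s → T (X s) → T (Ext 0 X G s)
    into G s x with G s
    ... | [] = from T-∧ (x , tt)
    out : ∀ (G : Vec A m → Vec A 0) s → T (Ext 0 X G s) → T (X s)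
    out G s t = proj₁ (to (T-∧ {X s}) t)
  ∃*-sem (suc n) {m} φ X = mk⇔
    (λ h → let G , F , h' = to (∃*-sem n (∃' φ) X) h in
           G' G F , ⊨-≋ φ (supplement-Ext n X G F (G' G F) (λ w → refl)) h')
    (λ { (G' , h) → from (∃*-sem n (∃' φ) X)
           ((λ w → V.tail (G' w)) , (λ v → V.head (G' (V.drop n v))) ,
            ⊨-≋ φ (≋-sym (supplement-Ext n X _ _ G' (split G'))) h) })
    where
    G' : (Vec A m → Vec A n) → (Vec A (n + m) → A) → Vec A m → Vec A (suc n)
    G' G F w = F (G w ++ w) ∷ G w
    split : ∀ (G' : Vec A m → Vec A (suc n)) w →
            G' w ≡ V.head (G' (V.drop n (V.tail (G' w) ++ w))) ∷ V.tail (G' w)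
    split G' w rewrite drop-++ (V.tail (G' w)) w = sym (head∷tail (G' w))

  clause-sem : ∀ {m} (c : List (FOLit τ m)) (X : Team (size 𝔄) m) →
               (X ⊨ clauseFm c) ⇔ (∀ s → T (X s) → T (evalC s c))
  clause-sem c X = mk⇔ (sound c X) (complete c X)
    where
    sound : ∀ {m} (c : List (FOLit τ m)) (X : Team (size 𝔄) m) → X ⊨ clauseFm c → ∀ s → T (X s) → T (evalC s c)
    sound []              X h = h
    sound (l ∷ [])        X h s x = from (T-∨ {evalL s l}) (inj₁ (h s x))
    sound (l ∷ c@(_ ∷ _)) X (Y , Z , split , hY , hZ) s x =
      from (T-∨ {evalL s l}) ([ (λ y → inj₁ (hY s y)) , (λ z → inj₂ (sound c Z hZ s z)) ]
                                (to (T-∨ {Y s}) (subst T (split s) x)))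
    complete : ∀ {m} (c : List (FOLit τ m)) (X : Team (size 𝔄) m) → (∀ s → T (X s) → T (evalC s c)) → X ⊨ clauseFm c
    complete []              X h = h
    complete (l ∷ [])        X h s x = [ (λ t → t) , (λ ()) ] (to (T-∨ {evalL s l} {false}) (h s x))
    complete (l ∷ c@(_ ∷ _)) X h =
      (λ s → X s ∧ evalL s l) , (λ s → X s ∧ not (evalL s l)) , (λ s → split (X s) (evalL s l)) ,
      (λ s t → proj₂ (to (T-∧ {X s}) t)) ,
      complete c _ (λ s t → rest s (to (T-∧ {X s}) t))
      where
      split : ∀ x b → x ≡ ((x ∧ b) ∨ (x ∧ not b))
      split false b     = refl
      split true  false = refl
      split true  true  = refl
      rest : ∀ s → T (X s) × T (not (evalL s l)) → T (evalC s c)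
      rest s (x , nl) = [ (λ t → ⊥-elim (T-not⁻ nl t)) , (λ t → t) ] (to (T-∨ {evalL s l}) (h s x))

  ⋀-sem : ∀ {m} (φs : List (DFm τ m)) (X : Team (size 𝔄) m) → (X ⊨ ⋀ φs) ⇔ All (X ⊨_) φs
  ⋀-sem φs X = mk⇔ (split φs) (join φs)
    where
    split : ∀ φs → X ⊨ ⋀ φs → All (X ⊨_) φs
    split []               h        = []
    split (φ ∷ [])         h        = h ∷ []
    split (φ ∷ φs@(_ ∷ _)) (h , hs) = h ∷ split φs hs
    join : ∀ φs → All (X ⊨_) φs → X ⊨ ⋀ φs
    join []               []       s _ = tt
    join (φ ∷ [])         (h ∷ []) = h
    join (φ ∷ φs@(_ ∷ _)) (h ∷ hs) = h , join φs hs

module SkolemForm {τ : Vocabulary} (𝔄 : Structure τ) {k : ℕ} (φ : BDHorn τ k) where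
  open TeamSem 𝔄
  open Eval {Const τ} {Rel τ} {arity τ} {size 𝔄} (constI 𝔄) (relI 𝔄)
  open TeamFacts 𝔄
  open BDHorn φ

  SkolemFn : Set
  SkolemFn = Vec A (p + k) → Vec A n

  asg : SkolemFn → Vec A p → Vec A k → Vec A (n + (p + k))
  asg G xs z = G (xs ++ z) ++ (xs ++ z)

  Functional : Team (size 𝔄) k → SkolemFn → Fin n → Set
  Functional X G i = ∀ {xs z xs' z'} → T (X z) → T (X z') →
                     L.map (lookup (xs ++ z)) (deps i) ≡ L.map (lookup (xs' ++ z')) (deps i) →
                     lookup (G (xs ++ z)) i ≡ lookup (G (xs' ++ z')) i

  record Skolem (X : Team (size 𝔄) k) (G : SkolemFn) : Set where
    field
      functional : ∀ i → Functional X G i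
      satisfies  : All (λ C → ∀ xs z → T (X z) → T (evalC (asg G xs z) (BD.BDClause.lits C))) clauses

  module _ (X : Team (size 𝔄) k) (G : SkolemFn) where
    Body-team : Team (size 𝔄) (n + (p + k))
    Body-team = Ext n (Dup p X) G

    member⁻ : ∀ {v} → T (Body-team v) → Σ (Vec A p) λ xs → Σ (Vec A k) λ z → T (X z) × v ≡ asg G xs z
    member⁻ t with Ext⁻ n {X = Dup p X} {G} t
    ... | w , x , refl = V.take p w , V.drop p w , x ,
                         subst (λ u → G w ++ w ≡ G u ++ u) (sym (VecP.take++drop≡id p w)) refl

    member⁺ : ∀ xs {z} → T (X z) → T (Body-team (asg G xs z))
    member⁺ xs {z} x = Ext⁺ n {X = Dup p X} {G} {xs ++ z} (subst (λ u → T (X u)) (sym (drop-++ xs z)) x)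

    dep-args : ∀ w (ds : List (Fin (p + k))) →
               L.map (evalT (G w ++ w)) (L.map (λ j → var (n ↑ʳ j)) ds) ≡ L.map (lookup w) ds
    dep-args w ds = trans (sym (ListP.map-∘ ds)) (ListP.map-cong (VecP.lookup-++ʳ (G w) w) ds)

    yDep : Fin n → DFm τ (n + (p + k))
    yDep i = dep (L.map (λ j → var (n ↑ʳ j)) (deps i)) (var (i ↑ˡ (p + k)))

    dep-sem : ∀ i → (Body-team ⊨ yDep i) ⇔ Functional X G i
    dep-sem i = mk⇔ forth back
      where
      value : ∀ w → evalT (G w ++ w) (var (i ↑ˡ (p + k))) ≡ lookup (G w) i
      value w = VecP.lookup-++ˡ (G w) w i
      forth : Body-team ⊨ yDep i → Functional X G i
      forth h {xs} {z} {xs'} {z'} x x' agree =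
        trans (sym (value (xs ++ z)))
          (trans (h (asg G xs z) (asg G xs' z') (member⁺ xs x) (member⁺ xs' x')
                    (trans (dep-args (xs ++ z) (deps i)) (trans agree (sym (dep-args (xs' ++ z') (deps i))))))
                 (value (xs' ++ z')))
      back : Functional X G i → Body-team ⊨ yDep i
      back h v v' t t' agree with member⁻ t | member⁻ t'
      ... | xs , z , x , refl | xs' , z' , x' , refl =
        trans (value (xs ++ z))
          (trans (h x x' (trans (sym (dep-args (xs ++ z) (deps i))) (trans agree (dep-args (xs' ++ z') (deps i)))))
                 (sym (value (xs' ++ z'))))

    clause-skolem : ∀ (c : List (FOLit τ (n + (p + k)))) →
                    (Body-team ⊨ clauseFm c) ⇔ (∀ xs z → T (X z) → T (evalC (asg G xs z) c))
    clause-skolem c = mk⇔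
      (λ h xs z x → to (clause-sem c Body-team) h (asg G xs z) (member⁺ xs x))
      (λ h → from (clause-sem c Body-team) λ v t → let xs , z , x , e = member⁻ t in
                                                    subst (λ u → T (evalC u c)) (sym e) (h xs z x))

  bd-skolem : (X : Team (size 𝔄) k) → (X ⊨ formula) ⇔ Σ SkolemFn (Skolem X)
  bd-skolem X = mk⇔ forth back
    where
    forth : X ⊨ formula → Σ SkolemFn (Skolem X)
    forth h with to (∃*-sem n body (Dup p X)) (to (∀*-sem p (∃* n body) X) h)
    ... | G , hd , hc = G , record
      { functional = λ i → to (dep-sem X G i)
                        (AllP.tabulate⁻ (AllP.map⁻ (to (⋀-sem _ (Body-team X G)) hd)) i)
      ; satisfies  = All.map (λ {C} → to (clause-skolem X G (BD.BDClause.lits C)))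
                        (AllP.map⁻ (to (⋀-sem _ (Body-team X G)) hc)) }
    back : Σ SkolemFn (Skolem X) → X ⊨ formula
    back (G , sk) = from (∀*-sem p (∃* n body) X) (from (∃*-sem n body (Dup p X)) (G ,
      from (⋀-sem _ (Body-team X G)) (AllP.map⁺ (AllP.tabulate⁺ (λ i → from (dep-sem X G i) (functional i)))) ,
      from (⋀-sem _ (Body-team X G)) (AllP.map⁺ (All.map (λ {C} → from (clause-skolem X G (BD.BDClause.lits C))) satisfies))))
      where open Skolem sk

-- Section 2.  The BD-Horn formula φ built from ψ

module Translation (τ : Vocabulary) (k : ℕ) (ψ : SOHorn τ k) where
  open SOHorn ψ renaming (p to pψ; clauses to cs; horn to hornψ)

  -- The relations whose truth values are coded: index zero is R, suc i is Pᵢ.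
  NP : ℕ
  NP = suc mP

  arityOf : Fin NP → ℕ
  arityOf zero    = k
  arityOf (suc i) = ars i

  -- Argument tuples are padded to blocks of a common width.
  width : ℕ
  width = sumFin NP arityOf

  arity≤width : ∀ i → arityOf i ≤ width
  arity≤width = summand≤sumFin NP arityOf

  literalsIn : List (List SLit) → ℕ
  literalsIn []       = 0
  literalsIn (c ∷ cs) = length c + literalsIn cs

  nLits : ℕ
  nLits = literalsIn cs

  length≤nLits : All (λ c → length c ≤ nLits) cs
  length≤nLits = bound cs
    where
    bound : ∀ xs → All (λ c → length c ≤ literalsIn xs) xs
    bound []       = []
    bound (c ∷ xs) = m≤m+n (length c) (literalsIn xs) ∷
                     All.map (λ le → ≤-trans le (m≤n+m _ (length c))) (bound xs)

  -- Slot 0 is a reference slot; the literal at position n of a clause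
  -- uses slot n + 1.
  nSlots : ℕ
  nSlots = suc (suc nLits)

  slotOf : ℕ → Fin nSlots
  slotOf n = suc (clamp nLits n)

  data UVar : Set where
    ψvar   : Fin pψ → UVar
    g₁ g₂  : UVar
    arg    : Fin NP → Fin nSlots → Fin width → UVar

  nBlocks : ℕ
  nBlocks = NP * nSlots

  nUniv : ℕ
  nUniv = pψ + suc (suc (nBlocks * width))

  encU : UVar → Fin nUniv
  encU (ψvar x)    = x ↑ˡ suc (suc (nBlocks * width))
  encU g₁          = pψ ↑ʳ zero
  encU g₂          = pψ ↑ʳ suc zero
  encU (arg i s j) = pψ ↑ʳ suc (suc (combine (combine i s) j))

  private
    argOf : Fin nBlocks × Fin width → UVar
    argOf (b , j) = let i , s = remQuot nSlots b in arg i s j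

    decodeRest : Fin pψ ⊎ Fin (suc (suc (nBlocks * width))) → UVar
    decodeRest (inj₁ x)             = ψvar x
    decodeRest (inj₂ zero)          = g₁
    decodeRest (inj₂ (suc zero))    = g₂
    decodeRest (inj₂ (suc (suc r))) = argOf (remQuot width r)

  decU : Fin nUniv → UVar
  decU x = decodeRest (splitAt pψ x)

  decU-encU : ∀ u → decU (encU u) ≡ u
  decU-encU (ψvar x)    = cong decodeRest (FinP.splitAt-↑ˡ pψ x _)
  decU-encU g₁          = cong decodeRest (FinP.splitAt-↑ʳ pψ _ zero)
  decU-encU g₂          = cong decodeRest (FinP.splitAt-↑ʳ pψ _ (suc zero))
  decU-encU (arg i s j) =
    trans (cong decodeRest (FinP.splitAt-↑ʳ pψ _ (suc (suc (combine (combine i s) j)))))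
          (trans (cong argOf (FinP.remQuot-combine {nBlocks} {width} (combine i s) j))
                 (cong (λ is → arg (proj₁ is) (proj₂ is) j) (FinP.remQuot-combine {NP} {nSlots} i s)))

  -- Existentially quantified variables: a flag for one-element structures
  -- and, for every relation and slot, a variable coding a truth value.
  data EVar : Set where
    flag  : EVar
    truth : Fin NP → Fin nSlots → EVar

  nEx : ℕ
  nEx = suc nBlocks

  encY : EVar → Fin nEx
  encY flag        = zero
  encY (truth i s) = suc (combine i s)

  private
    truthOf : Fin NP × Fin nSlots → EVar
    truthOf (i , s) = truth i s

  decY : Fin nEx → EVar
  decY zero    = flag
  decY (suc b) = truthOf (remQuot nSlots b)

  decY-encY : ∀ y → decY (encY y) ≡ y
  decY-encY flag        = refl
  decY-encY (truth i s) = cong truthOf (FinP.remQuot-combine {NP} {nSlots} i s)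

  nOuter : ℕ
  nOuter = nUniv + k

  Tm : Set
  Tm = Term (Const τ) (nEx + nOuter)

  Lit : Set
  Lit = FOLit τ (nEx + nOuter)

  uvar : UVar → Tm
  uvar u = var (nEx ↑ʳ (encU u ↑ˡ k))

  zvar : Fin k → Tm
  zvar j = var (nEx ↑ʳ (nUniv ↑ʳ j))

  yvar : EVar → Tm
  yvar y = var (encY y ↑ˡ nOuter)

  zeroC : Tm
  zeroC = con (c0 τ)

  isTrue : EVar → Lit
  isTrue y = pos (yvar y ≐ zeroC)

  isFalse : EVar → Lit
  isFalse y = neg (yvar y ≐ zeroC)

  liftTerm : Term (Const τ) pψ → Tm
  liftTerm (var x) = uvar (ψvar x)
  liftTerm (con c) = con c

  liftAtom : (r : Rel τ) → Vec (Term (Const τ) pψ) (arity τ r) → Atom (Const τ) (Rel τ) (arity τ) (nEx + nOuter)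
  liftAtom r ts = rel r (V.map liftTerm ts)

  padTerms : ∀ {a} m → Vec Tm a → Vec Tm m
  padTerms zero    _        = []
  padTerms (suc m) []       = zeroC ∷ padTerms m []
  padTerms (suc m) (t ∷ ts) = t ∷ padTerms m ts

  argBlock : ∀ {a} → Vec (Term (Const τ) pψ) a → Vec Tm width
  argBlock ts = padTerms width (V.map liftTerm ts)

  differs : (Fin width → Tm) → (Fin width → Tm) → List Lit
  differs u b = L.map (λ j → neg (u j ≐ b j)) (L.allFin width)

  block : Fin NP → Fin nSlots → Fin width → Tm
  block i s j = uvar (arg i s j)

  unlessBlock : Fin NP → Fin nSlots → Vec Tm width → Lit → List Lit
  unlessBlock i s ts l = differs (block i s) (lookup ts) L.++ (l ∷ [])

  -- R occurs only
  -- negatively; a positive R-atom is translated to ⊥ (it never occurs).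
  trLit : Fin nSlots → SLit → List Lit
  trLit s (pos (rel (τrel r) ts)) = pos (liftAtom r ts) ∷ []
  trLit s (neg (rel (τrel r) ts)) = neg (liftAtom r ts) ∷ []
  trLit s (pos (rel Rsym ts))     = pos bot ∷ []
  trLit s (neg (rel Rsym ts))     = unlessBlock zero s (argBlock ts) (isFalse (truth zero s))
  trLit s (pos (rel (Psym i) ts)) = unlessBlock (suc i) s (argBlock ts) (isTrue (truth (suc i) s))
  trLit s (neg (rel (Psym i) ts)) = unlessBlock (suc i) s (argBlock ts) (isFalse (truth (suc i) s))
  trLit s (pos (t ≐ u))           = pos (liftTerm t ≐ liftTerm u) ∷ []
  trLit s (neg (t ≐ u))           = neg (liftTerm t ≐ liftTerm u) ∷ []
  trLit s (pos bot)               = pos bot ∷ []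
  trLit s (neg bot)               = neg bot ∷ []
  trLit s (pos top)               = pos top ∷ []
  trLit s (neg top)               = neg top ∷ []

  trCl : ℕ → List SLit → List Lit
  trCl n []      = []
  trCl n (l ∷ c) = trLit (slotOf n) l L.++ trCl (suc n) c

  guardedCl : List SLit → List Lit
  guardedCl c = pos (uvar g₁ ≐ uvar g₂) ∷ trCl 0 c

  -- consistency with the reference slot: equal blocks code equal truth values
  consDown consUp : Fin NP → Fin nSlots → List Lit
  consDown i s = differs (block i s) (block i zero) L.++ (isFalse (truth i s) ∷ isTrue (truth i zero) ∷ [])
  consUp   i s = differs (block i s) (block i zero) L.++ (isFalse (truth i zero) ∷ isTrue (truth i s) ∷ [])

  RCl : List Lit
  RCl = unlessBlock zero zero (padTerms width (tabulate zvar)) (isTrue (truth zero zero))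

  -- One-element structures.  There every predicate is empty or full, and
  -- stripLit b l is the value of l when Pᵢ is full iff bᵢ (and R is full).
  valuations : List (Vec Bool mP)
  valuations = allVecs (true ∷ false ∷ []) mP

  stripLit : Vec Bool mP → SLit → Lit
  stripLit b (pos (rel (τrel r) ts)) = pos (liftAtom r ts)
  stripLit b (neg (rel (τrel r) ts)) = neg (liftAtom r ts)
  stripLit b (pos (rel Rsym ts))     = pos top
  stripLit b (neg (rel Rsym ts))     = pos bot
  stripLit b (pos (rel (Psym i) ts)) = if lookup b i then pos top else pos bot
  stripLit b (neg (rel (Psym i) ts)) = if lookup b i then pos bot else pos top
  stripLit b (pos (t ≐ u))           = pos (liftTerm t ≐ liftTerm u)
  stripLit b (neg (t ≐ u))           = neg (liftTerm t ≐ liftTerm u)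
  stripLit b (pos bot)               = pos bot
  stripLit b (neg bot)               = neg bot
  stripLit b (pos top)               = pos top
  stripLit b (neg top)               = neg top

  nCls : ℕ
  nCls = length cs

  -- For a choice fs of one clause of ψ per valuation b: the disjunction,
  -- over b, of clause fs(b) under b.  All of these hold iff some
  -- valuation satisfies every clause (distributivity).
  choiceDisj : (bs : List (Vec Bool mP)) → Vec (Fin nCls) (length bs) → List Lit
  choiceDisj []       []       = []
  choiceDisj (b ∷ bs) (f ∷ fs) = L.map (stripLit b) (L.lookup cs f) L.++ choiceDisj bs fs

  -- guarded by "flag ≠ 0", which can only fail in one-element structures
  oneElemCl : Vec (Fin nCls) (length valuations) → List Lit
  oneElemCl fs = isFalse flag ∷ choiceDisj valuations fs

  depsOf : EVar → List (Fin nOuter)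
  depsOf flag        = []
  depsOf (truth i s) = L.map (λ j → encU (arg i s j) ↑ˡ k) (L.allFin width)

  open BD τ nEx nOuter

  NotEx : Tm → Set
  NotEx t = ¬ IsEx t

  notEx-var : ∀ x → NotEx (var (nEx ↑ʳ x))
  notEx-var x (i , e) with trans (sym (FinP.splitAt-↑ʳ nEx nOuter x))
                               (trans (cong (splitAt nEx) (var-injective e)) (FinP.splitAt-↑ˡ nEx i nOuter))
    where
    var-injective : ∀ {a b : Fin (nEx + nOuter)} → _≡_ {A = Tm} (var a) (var b) → a ≡ b
    var-injective refl = refl
  ... | ()

  notEx-con : ∀ c → NotEx (con c)
  notEx-con c (i , ())

  notEx-lift : ∀ t → NotEx (liftTerm t)
  notEx-lift (var x) = notEx-var _
  notEx-lift (con c) = notEx-con c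

  notEx-pad : ∀ {a} m (ts : Vec Tm a) → (∀ j → NotEx (lookup ts j)) → ∀ j → NotEx (lookup (padTerms m ts) j)
  notEx-pad (suc m) []       h zero    = notEx-con _
  notEx-pad (suc m) []       h (suc j) = notEx-pad m [] h j
  notEx-pad (suc m) (t ∷ ts) h zero    = h zero
  notEx-pad (suc m) (t ∷ ts) h (suc j) = notEx-pad m ts (λ j → h (suc j)) j

  notEx-argBlock : ∀ {a} (ts : Vec (Term (Const τ) pψ) a) j → NotEx (lookup (argBlock ts) j)
  notEx-argBlock ts = notEx-pad width (V.map liftTerm ts) (lifted ts)
    where
    lifted : ∀ {a} (ts : Vec (Term (Const τ) pψ) a) j → NotEx (lookup (V.map liftTerm ts) j)
    lifted (t ∷ ts) zero    = notEx-lift t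
    lifted (t ∷ ts) (suc j) = lifted ts j

  Plain : Lit → Set
  Plain l = ¬ ExOcc (atomOf l)

  plain-≐ : ∀ {t u} → NotEx t → NotEx u → ¬ ExOcc (t ≐ u)
  plain-≐ nt nu = [ nt , nu ]

  plain-liftAtom : ∀ r ts → ¬ ExOcc (liftAtom r ts)
  plain-liftAtom r ts = noAny ts
    where
    noAny : ∀ {a} (ts : Vec (Term (Const τ) pψ) a) → AnyV IsEx (V.map liftTerm ts) → ⊥
    noAny (t ∷ ts) (here e)  = notEx-lift t e
    noAny (t ∷ ts) (there a) = noAny ts a

  OkEx : Lit → Set
  OkEx l = ExOcc (atomOf l) → ExAtom (atomOf l)

  NotPosEx : Lit → Set
  NotPosEx l = ¬ PosEx l

  plain-ok : ∀ {l} → Plain l → OkEx l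
  plain-ok pl e = ⊥-elim (pl e)

  plain-notPosEx : ∀ {l} → Plain l → NotPosEx l
  plain-notPosEx pl (a , refl , e) = pl e

  neg-notPosEx : ∀ a → NotPosEx (neg a)
  neg-notPosEx a (_ , () , _)

  ok-isTrue : ∀ y → OkEx (isTrue y)
  ok-isTrue y _ = y=0 (encY y)

  ok-isFalse : ∀ y → OkEx (isFalse y)
  ok-isFalse y _ = y=0 (encY y)

  AllPlain : List Lit → Set
  AllPlain = All Plain

  allPlain-ok : ∀ {ls} → AllPlain ls → All OkEx ls
  allPlain-ok = All.map (λ {l} → plain-ok {l})

  allPlain-notPosEx : ∀ {ls} → AllPlain ls → All NotPosEx ls
  allPlain-notPosEx = All.map (λ {l} → plain-notPosEx {l})

  differs-plain : ∀ (u b : Fin width → Tm) → (∀ j → NotEx (u j)) → (∀ j → NotEx (b j)) → AllPlain (differs u b)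
  differs-plain u b nu nb = AllP.map⁺ (AllP.tabulate⁺ (λ j → plain-≐ (nu j) (nb j)))

  block-notEx : ∀ i s j → NotEx (block i s j)
  block-notEx i s j = notEx-var _

  WellFormed : List Lit → Set
  WellFormed ls = All OkEx ls × AtMostOne PosEx ls

  mkClause : (ls : List Lit) → WellFormed ls → BDClause
  mkClause ls (ok , amo) = record { lits = ls ; onlyEx = ok ; horn = AtMostOne⇒unique amo }

  unlessBlock-wf : ∀ i s ts y → (∀ j → NotEx (lookup ts j)) → (l : Lit) → l ≡ isTrue y ⊎ l ≡ isFalse y →
                   WellFormed (unlessBlock i s ts l)
  unlessBlock-wf i s ts y nts l l≡ =
    AllP.++⁺ (allPlain-ok pl) (ok ∷ []) , AtMostOne-++ˡ (allPlain-notPosEx pl) (this [])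
    where
    pl : AllPlain (differs (block i s) (lookup ts))
    pl = differs-plain (block i s) (lookup ts) (block-notEx i s) nts
    ok : OkEx l
    ok = [ (λ { refl → ok-isTrue y }) , (λ { refl → ok-isFalse y }) ] l≡

  unlessBlock-notPos : ∀ i s ts y → (∀ j → NotEx (lookup ts j)) → All NotPosEx (unlessBlock i s ts (isFalse y))
  unlessBlock-notPos i s ts y nts =
    AllP.++⁺ (allPlain-notPosEx (differs-plain (block i s) (lookup ts) (block-notEx i s) nts)) (neg-notPosEx _ ∷ [])

  isPosP : (l : SLit) → PosP l ⊎ ¬ PosP l
  isPosP (pos (rel (Psym i) ts))  = inj₁ (i , ts , refl)
  isPosP (pos (rel (τrel r) ts))  = inj₂ (λ { (_ , _ , ()) })
  isPosP (pos (rel Rsym ts))      = inj₂ (λ { (_ , _ , ()) })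
  isPosP (pos (t ≐ u))            = inj₂ (λ { (_ , _ , ()) })
  isPosP (pos bot)                = inj₂ (λ { (_ , _ , ()) })
  isPosP (pos top)                = inj₂ (λ { (_ , _ , ()) })
  isPosP (neg a)                  = inj₂ (λ { (_ , _ , ()) })

  trLit-ok : ∀ s l → All OkEx (trLit s l)
  trLit-ok s (pos (rel (τrel r) ts)) = plain-ok {pos (liftAtom r ts)} (plain-liftAtom r ts) ∷ []
  trLit-ok s (neg (rel (τrel r) ts)) = plain-ok {neg (liftAtom r ts)} (plain-liftAtom r ts) ∷ []
  trLit-ok s (pos (rel Rsym ts))     = plain-ok {pos bot} (λ ()) ∷ []
  trLit-ok s (neg (rel Rsym ts))     = proj₁ (unlessBlock-wf zero s (argBlock ts) (truth zero s) (notEx-argBlock ts) _ (inj₂ refl))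
  trLit-ok s (pos (rel (Psym i) ts)) = proj₁ (unlessBlock-wf (suc i) s (argBlock ts) (truth (suc i) s) (notEx-argBlock ts) _ (inj₁ refl))
  trLit-ok s (neg (rel (Psym i) ts)) = proj₁ (unlessBlock-wf (suc i) s (argBlock ts) (truth (suc i) s) (notEx-argBlock ts) _ (inj₂ refl))
  trLit-ok s (pos (t ≐ u))           = plain-ok {pos (liftTerm t ≐ liftTerm u)} (plain-≐ (notEx-lift t) (notEx-lift u)) ∷ []
  trLit-ok s (neg (t ≐ u))           = plain-ok {neg (liftTerm t ≐ liftTerm u)} (plain-≐ (notEx-lift t) (notEx-lift u)) ∷ []
  trLit-ok s (pos bot)               = plain-ok {pos bot} (λ ()) ∷ []
  trLit-ok s (neg bot)               = plain-ok {neg bot} (λ ()) ∷ []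
  trLit-ok s (pos top)               = plain-ok {pos top} (λ ()) ∷ []
  trLit-ok s (neg top)               = plain-ok {neg top} (λ ()) ∷ []

  trLit-notPos : ∀ s l → ¬ PosP l → All NotPosEx (trLit s l)
  trLit-notPos s (pos (rel (τrel r) ts)) np = plain-notPosEx {pos (liftAtom r ts)} (plain-liftAtom r ts) ∷ []
  trLit-notPos s (neg (rel (τrel r) ts)) np = neg-notPosEx _ ∷ []
  trLit-notPos s (pos (rel Rsym ts))     np = plain-notPosEx {pos bot} (λ ()) ∷ []
  trLit-notPos s (neg (rel Rsym ts))     np = unlessBlock-notPos zero s (argBlock ts) (truth zero s) (notEx-argBlock ts)
  trLit-notPos s (pos (rel (Psym i) ts)) np = ⊥-elim (np (i , ts , refl))
  trLit-notPos s (neg (rel (Psym i) ts)) np = unlessBlock-notPos (suc i) s (argBlock ts) (truth (suc i) s) (notEx-argBlock ts)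
  trLit-notPos s (pos (t ≐ u))           np = plain-notPosEx {pos (liftTerm t ≐ liftTerm u)} (plain-≐ (notEx-lift t) (notEx-lift u)) ∷ []
  trLit-notPos s (neg (t ≐ u))           np = neg-notPosEx _ ∷ []
  trLit-notPos s (pos bot)               np = plain-notPosEx {pos bot} (λ ()) ∷ []
  trLit-notPos s (neg bot)               np = neg-notPosEx _ ∷ []
  trLit-notPos s (pos top)               np = plain-notPosEx {pos top} (λ ()) ∷ []
  trLit-notPos s (neg top)               np = neg-notPosEx _ ∷ []

  trLit-amo : ∀ s l → AtMostOne PosEx (trLit s l)
  trLit-amo s l with isPosP l
  ... | inj₂ np = none→AtMostOne (trLit-notPos s l np)
  ... | inj₁ (i , ts , refl) = proj₂ (unlessBlock-wf (suc i) s (argBlock ts) (truth (suc i) s) (notEx-argBlock ts) _ (inj₁ refl))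

  trCl-ok : ∀ n c → All OkEx (trCl n c)
  trCl-ok n []      = []
  trCl-ok n (l ∷ c) = AllP.++⁺ (trLit-ok _ l) (trCl-ok (suc n) c)

  trCl-notPos : ∀ n c → All (λ l → ¬ PosP l) c → All NotPosEx (trCl n c)
  trCl-notPos n []      _          = []
  trCl-notPos n (l ∷ c) (np ∷ nps) = AllP.++⁺ (trLit-notPos _ l np) (trCl-notPos (suc n) c nps)

  trCl-amo : ∀ n c → AtMostOne PosP c → AtMostOne PosEx (trCl n c)
  trCl-amo n []      _            = []
  trCl-amo n (l ∷ c) (skip np a)  = AtMostOne-++ˡ (trLit-notPos _ l np) (trCl-amo (suc n) c a)
  trCl-amo n (l ∷ c) (this nps)   = AtMostOne-++ʳ (trLit-amo _ l) (trCl-notPos (suc n) c nps)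

  guard-plain : Plain (pos (uvar g₁ ≐ uvar g₂))
  guard-plain = plain-≐ (notEx-var _) (notEx-var _)

  guardedCl-wf : ∀ c → (∀ i j → PosP (L.lookup c i) → PosP (L.lookup c j) → i ≡ j) → WellFormed (guardedCl c)
  guardedCl-wf c h = (plain-ok {pos (uvar g₁ ≐ uvar g₂)} guard-plain ∷ trCl-ok 0 c) ,
                     skip (plain-notPosEx {pos (uvar g₁ ≐ uvar g₂)} guard-plain)
                          (trCl-amo 0 c (unique⇒AtMostOne isPosP c h))

  cons-wf : ∀ i s y y' → WellFormed (differs (block i s) (block i zero) L.++ (isFalse y ∷ isTrue y' ∷ []))
  cons-wf i s y y' = AllP.++⁺ (allPlain-ok pl) (ok-isFalse y ∷ ok-isTrue y' ∷ []) ,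
                     AtMostOne-++ˡ (allPlain-notPosEx pl) (skip (neg-notPosEx _) (this []))
    where
    pl : AllPlain (differs (block i s) (block i zero))
    pl = differs-plain (block i s) (block i zero) (block-notEx i s) (block-notEx i zero)

  RCl-wf : WellFormed RCl
  RCl-wf = unlessBlock-wf zero zero (padTerms width (tabulate zvar)) (truth zero zero) (notEx-pad width (tabulate zvar) notEx-zvar) _ (inj₁ refl)
    where
    notEx-zvar : ∀ j → NotEx (lookup (tabulate zvar) j)
    notEx-zvar j rewrite VecP.lookup∘tabulate zvar j = notEx-var _

  stripLit-plain : ∀ b l → Plain (stripLit b l)
  stripLit-plain b (pos (rel (τrel r) ts)) = plain-liftAtom r ts
  stripLit-plain b (neg (rel (τrel r) ts)) = plain-liftAtom r ts
  stripLit-plain b (pos (rel Rsym ts))     = λ ()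
  stripLit-plain b (neg (rel Rsym ts))     = λ ()
  stripLit-plain b (pos (rel (Psym i) ts)) with lookup b i
  ... | true  = λ ()
  ... | false = λ ()
  stripLit-plain b (neg (rel (Psym i) ts)) with lookup b i
  ... | true  = λ ()
  ... | false = λ ()
  stripLit-plain b (pos (t ≐ u))           = plain-≐ (notEx-lift t) (notEx-lift u)
  stripLit-plain b (neg (t ≐ u))           = plain-≐ (notEx-lift t) (notEx-lift u)
  stripLit-plain b (pos bot)               = λ ()
  stripLit-plain b (neg bot)               = λ ()
  stripLit-plain b (pos top)               = λ ()
  stripLit-plain b (neg top)               = λ ()

  choiceDisj-plain : ∀ bs fs → AllPlain (choiceDisj bs fs)
  choiceDisj-plain []       []       = []
  choiceDisj-plain (b ∷ bs) (f ∷ fs) =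
    AllP.++⁺ (AllP.map⁺ (All.universal (stripLit-plain b) _)) (choiceDisj-plain bs fs)

  oneElemCl-wf : ∀ fs → WellFormed (oneElemCl fs)
  oneElemCl-wf fs = (ok-isFalse flag ∷ allPlain-ok pl) , none→AtMostOne (neg-notPosEx _ ∷ allPlain-notPosEx pl)
    where
    pl : AllPlain (choiceDisj valuations fs)
    pl = choiceDisj-plain valuations fs

  guardedCls : (xs : List (List SLit)) →
               All (λ c → ∀ (i j : Fin (length c)) → PosP (L.lookup c i) → PosP (L.lookup c j) → i ≡ j) xs →
               List BDClause
  guardedCls []       []       = []
  guardedCls (c ∷ xs) (h ∷ hs) = mkClause (guardedCl c) (guardedCl-wf c h) ∷ guardedCls xs hs

  perBlock : (f : Fin NP → Fin nSlots → List Lit) → (∀ i s → WellFormed (f i s)) → List BDClause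
  perBlock f wf = L.concat (L.map (λ i → L.map (λ s → mkClause (f i s) (wf i s)) (L.allFin nSlots)) (L.allFin NP))

  oneElemCls : List BDClause
  oneElemCls = L.map (λ fs → mkClause (oneElemCl fs) (oneElemCl-wf fs)) (allVecs (L.allFin nCls) (length valuations))

  consDown-wf : ∀ i s → WellFormed (consDown i s)
  consDown-wf i s = cons-wf i s (truth i s) (truth i zero)
  consUp-wf : ∀ i s → WellFormed (consUp i s)
  consUp-wf i s = cons-wf i s (truth i zero) (truth i s)

  allCls : List BDClause
  allCls = oneElemCls L.++ (perBlock consDown consDown-wf L.++
           (perBlock consUp consUp-wf L.++ (mkClause RCl RCl-wf ∷ guardedCls cs hornψ)))

  φ : BDHorn τ k
  φ = record { p = nUniv ; n = nEx ; deps = λ y → depsOf (decY y) ; clauses = allCls }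

-- Section 3.  Evaluating the clauses of φ

module Evaluation (τ : Vocabulary) (k : ℕ) (ψ : SOHorn τ k) (𝔄 : Structure τ) where
  open SOHorn ψ renaming (p to pψ; clauses to cs; horn to hornψ)
  open Translation τ k ψ
  open TeamSem 𝔄 using (A)
  open Eval {Const τ} {Rel τ} {arity τ} {size 𝔄} (constI 𝔄) (relI 𝔄)

  c0v : A
  c0v = constI 𝔄 (c0 τ)

  SymInterp : Set
  SymInterp = (r : SOSym τ mP) → Vec A (soArity τ k mP ars r) → Bool

  module Eψ (rI : SymInterp) = Eval {Const τ} {SOSym τ mP} {soArity τ k mP ars} {size 𝔄} (constI 𝔄) rI

  Preds : Set
  Preds = (i : Fin mP) → Vec A (ars i) → Bool

  record Expands (rI : SymInterp) (X : Team (size 𝔄) k) (Ps : Preds) : Set where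
    field
      onτ : ∀ r u → rI (τrel r) u ≡ relI 𝔄 r u
      onR : ∀ u → rI Rsym u ≡ X u
      onP : ∀ i u → rI (Psym i) u ≡ Ps i u

  Satisfies : SymInterp → Set
  Satisfies rI = ∀ xp → All (λ c → T (Eψ.evalC rI xp c)) cs

  data PlainSLit : SLit → Set where
    pτ : ∀ r ts → PlainSLit (pos (rel (τrel r) ts))
    nτ : ∀ r ts → PlainSLit (neg (rel (τrel r) ts))
    p≐ : ∀ t u → PlainSLit (pos (t ≐ u))
    n≐ : ∀ t u → PlainSLit (neg (t ≐ u))
    p⊥ : PlainSLit (pos bot)
    n⊥ : PlainSLit (neg bot)
    p⊤ : PlainSLit (pos top)
    n⊤ : PlainSLit (neg top)

  pad : ∀ {a} m → Vec A a → Vec A m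
  pad zero    _        = []
  pad (suc m) []       = c0v ∷ pad m []
  pad (suc m) (x ∷ xs) = x ∷ pad m xs

  unpad : ∀ a {m} → Vec A m → Vec A a
  unpad zero    _        = []
  unpad (suc a) []       = c0v ∷ unpad a []
  unpad (suc a) (x ∷ xs) = x ∷ unpad a xs

  unpad-pad : ∀ {a} m (b : Vec A a) → a ≤ m → unpad a (pad m b) ≡ b
  unpad-pad m       []      _         = refl
  unpad-pad (suc m) (x ∷ b) (s≤s a≤m) = cong (x ∷_) (unpad-pad m b a≤m)

  ψAsg : Vec A nUniv → Vec A pψ
  ψAsg xs = tabulate (λ x → lookup xs (encU (ψvar x)))

  blockVal : Vec A nUniv → Fin NP → Fin nSlots → Vec A width
  blockVal xs i s = tabulate (λ j → lookup xs (encU (arg i s j)))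

  mkUniv : (UVar → A) → Vec A nUniv
  mkUniv f = tabulate (λ x → f (decU x))

  mkUniv-lookup : ∀ f u → lookup (mkUniv f) (encU u) ≡ f u
  mkUniv-lookup f u = trans (VecP.lookup∘tabulate _ (encU u)) (cong f (decU-encU u))

  evalC-++ : ∀ {m} (v : Vec A m) (xs ys : List (FOLit τ m)) → T (evalC v (xs L.++ ys)) ⇔ (T (evalC v xs) ⊎ T (evalC v ys))
  evalC-++ v xs ys = mk⇔ (λ t → to (T-∨ {evalC v xs}) (subst T (eq xs) t))
                         (λ h → subst T (sym (eq xs)) (from (T-∨ {evalC v xs}) h))
    where
    eq : ∀ xs → evalC v (xs L.++ ys) ≡ (evalC v xs ∨ evalC v ys)
    eq []       = refl
    eq (l ∷ xs) = trans (cong (evalL v l ∨_) (eq xs)) (sym (∨-assoc (evalL v l) (evalC v xs) (evalC v ys)))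

  differs-false : ∀ {m} (v : Vec A m) (u b : Fin width → Term (Const τ) m) →
                  (¬ T (evalC v (L.map (λ j → neg (u j ≐ b j)) (L.allFin width)))) ⇔ (∀ j → evalT v (u j) ≡ evalT v (b j))
  differs-false {m} v u b = mk⇔ (λ nt → agree width u b (nt ∘ subst T (sym (cong (evalC v) (tab u b)))))
                           (λ h t → disagree width u b h (subst T (cong (evalC v) (tab u b)) t))
    where
    tab : ∀ u b → L.map (λ j → neg (u j ≐ b j)) (L.allFin width) ≡ L.tabulate (λ j → neg (u j ≐ b j))
    tab u b = ListP.map-tabulate (λ x → x) (λ j → neg (u j ≐ b j))
    agree : ∀ n (u b : Fin n → Term (Const τ) m) → ¬ T (evalC v (L.tabulate (λ j → neg (u j ≐ b j)))) →
            ∀ j → evalT v (u j) ≡ evalT v (b j)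
    agree (suc n) u b nt j with evalT v (u zero) ≟ evalT v (b zero)
    agree (suc n) u b nt zero    | yes e = e
    agree (suc n) u b nt (suc j) | yes e = agree n (λ j → u (suc j)) (λ j → b (suc j)) nt j
    ... | no _ = ⊥-elim (nt tt)
    disagree : ∀ n (u b : Fin n → Term (Const τ) m) → (∀ j → evalT v (u j) ≡ evalT v (b j)) →
               ¬ T (evalC v (L.tabulate (λ j → neg (u j ≐ b j))))
    disagree (suc n) u b h t with evalT v (u zero) ≟ evalT v (b zero)
    ... | yes _ = disagree n (λ j → u (suc j)) (λ j → b (suc j)) (λ j → h (suc j)) t
    ... | no ne = ne (h zero)

  differs-or : ∀ {m} (v : Vec A m) (u b : Fin width → Term (Const τ) m) (rest : List (FOLit τ m)) →
               T (evalC v (L.map (λ j → neg (u j ≐ b j)) (L.allFin width) L.++ rest)) ⇔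
               ((∀ j → evalT v (u j) ≡ evalT v (b j)) → T (evalC v rest))
  differs-or {m} v u b rest = mk⇔
    (λ t agree → [ (λ d → ⊥-elim (from (differs-false v u b) agree d)) , (λ r → r) ] (to (evalC-++ v D rest) t))
    (λ h → from (evalC-++ v D rest) (decide h))
    where
    D : List (FOLit τ m)
    D = L.map (λ j → neg (u j ≐ b j)) (L.allFin width)
    decide : ((∀ j → evalT v (u j) ≡ evalT v (b j)) → T (evalC v rest)) → T (evalC v D) ⊎ T (evalC v rest)
    decide h with T? (evalC v D)
    ... | yes d = inj₁ d
    ... | no nd = inj₂ (h (to (differs-false v u b) nd))

  single : ∀ {m} (v : Vec A m) l → T (evalC v (l ∷ [])) ⇔ T (evalL v l)
  single v l = ∨-false

  module _ (ys : Vec A nEx) (xs : Vec A nUniv) (z : Vec A k) where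
    private
      v : Vec A (nEx + nOuter)
      v = ys ++ (xs ++ z)

    uvar-val : ∀ u → evalT v (uvar u) ≡ lookup xs (encU u)
    uvar-val u = trans (VecP.lookup-++ʳ ys (xs ++ z) (encU u ↑ˡ k)) (VecP.lookup-++ˡ xs z (encU u))

    zvars-val : V.map (evalT v) (tabulate zvar) ≡ z
    zvars-val = trans (sym (VecP.tabulate-∘ (evalT v) zvar))
                      (trans (VecP.tabulate-cong (λ j → trans (VecP.lookup-++ʳ ys (xs ++ z) (nUniv ↑ʳ j))
                                                               (VecP.lookup-++ʳ xs z j)))
                             (VecP.tabulate∘lookup z))

    yvar-val : ∀ y → evalT v (yvar y) ≡ lookup ys (encY y)
    yvar-val y = VecP.lookup-++ˡ ys (xs ++ z) (encY y)

    isTrue-sem : ∀ y → T (evalL v (isTrue y)) ⇔ lookup ys (encY y) ≡ c0v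
    isTrue-sem y = mk⇔ (λ t → trans (sym (yvar-val y)) (toWitness t))
                       (λ e → fromWitness (trans (yvar-val y) e))

    isFalse-sem : ∀ y → T (evalL v (isFalse y)) ⇔ (¬ lookup ys (encY y) ≡ c0v)
    isFalse-sem y = mk⇔ (λ t e → toWitnessFalse t (trans (yvar-val y) e))
                        (λ ne → fromWitnessFalse (λ e → ne (trans (sym (yvar-val y)) e)))

    liftTerm-val : ∀ rI t → evalT v (liftTerm t) ≡ Eψ.evalT rI (ψAsg xs) t
    liftTerm-val rI (var x) = trans (uvar-val (ψvar x)) (sym (VecP.lookup∘tabulate _ x))
    liftTerm-val rI (con c) = refl

    liftTerms-val : ∀ rI {a} (ts : Vec (Term (Const τ) pψ) a) →
                    V.map (evalT v) (V.map liftTerm ts) ≡ V.map (Eψ.evalT rI (ψAsg xs)) ts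
    liftTerms-val rI []       = refl
    liftTerms-val rI (t ∷ ts) = cong₂ _∷_ (liftTerm-val rI t) (liftTerms-val rI ts)

    padTerms-val : ∀ {a} m (ts : Vec Tm a) → V.map (evalT v) (padTerms m ts) ≡ pad m (V.map (evalT v) ts)
    padTerms-val zero    ts       = refl
    padTerms-val (suc m) []       = cong (c0v ∷_) (padTerms-val m [])
    padTerms-val (suc m) (t ∷ ts) = cong (evalT v t ∷_) (padTerms-val m ts)

    zblock-val : V.map (evalT v) (padTerms width (tabulate zvar)) ≡ pad width z
    zblock-val = trans (padTerms-val width (tabulate zvar)) (cong (pad width) zvars-val)

    argBlock-val : ∀ rI {a} (ts : Vec (Term (Const τ) pψ) a) →
                   V.map (evalT v) (argBlock ts) ≡ pad width (V.map (Eψ.evalT rI (ψAsg xs)) ts)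
    argBlock-val rI ts = trans (padTerms-val width (V.map liftTerm ts)) (cong (pad width) (liftTerms-val rI ts))

    blocks-agree : ∀ i s (b : Fin width → Tm) →
                   (∀ j → evalT v (block i s j) ≡ evalT v (b j)) ⇔ (blockVal xs i s ≡ tabulate (λ j → evalT v (b j)))
    blocks-agree i s b = mk⇔
      (λ h → VecP.tabulate-cong (λ j → trans (sym (uvar-val (arg i s j))) (h j)))
      (λ e j → trans (uvar-val (arg i s j))
                     (trans (sym (VecP.lookup∘tabulate _ j))
                            (trans (cong (λ w → lookup w j) e) (VecP.lookup∘tabulate _ j))))

    unlessBlock-sem : ∀ i s (ts : Vec Tm width) l →
                      T (evalC v (unlessBlock i s ts l)) ⇔ (blockVal xs i s ≡ V.map (evalT v) ts → T (evalL v l))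
    unlessBlock-sem i s ts l = mk⇔
      (λ t e → to (single v l) (to (differs-or v (block i s) (lookup ts) (l ∷ [])) t
                                   (from (blocks-agree i s (lookup ts)) (trans e (tab-map ts)))))
      (λ h → from (differs-or v (block i s) (lookup ts) (l ∷ []))
                  (λ agree → from (single v l) (h (trans (to (blocks-agree i s (lookup ts)) agree) (sym (tab-map ts))))))
      where
      tab-map : ∀ (ts : Vec Tm width) → V.map (evalT v) ts ≡ tabulate (λ j → evalT v (lookup ts j))
      tab-map ts = trans (cong (V.map (evalT v)) (sym (VecP.tabulate∘lookup ts))) (sym (VecP.tabulate-∘ (evalT v) (lookup ts)))

    cons-sem : ∀ i s y y' →
               T (evalC v (differs (block i s) (block i zero) L.++ (isFalse y ∷ isTrue y' ∷ []))) ⇔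
               (blockVal xs i s ≡ blockVal xs i zero → lookup ys (encY y) ≡ c0v → lookup ys (encY y') ≡ c0v)
    cons-sem i s y y' = mk⇔
      (λ t e y0 → to (isTrue-sem y') (implies (to (differs-or v (block i s) (block i zero) _) t (agree e))
                                                (from (isTrue-sem y) y0)))
      (λ h → from (differs-or v (block i s) (block i zero) _) λ a →
               unimplies (λ y0 → from (isTrue-sem y') (h (disagree a) (to (isTrue-sem y) y0))))
      where
      blockTerms : blockVal xs i zero ≡ tabulate (λ j → evalT v (block i zero j))
      blockTerms = VecP.tabulate-cong (λ j → sym (uvar-val (arg i zero j)))
      agree : blockVal xs i s ≡ blockVal xs i zero → ∀ j → evalT v (block i s j) ≡ evalT v (block i zero j)
      agree e = from (blocks-agree i s (block i zero)) (trans e blockTerms)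
      disagree : (∀ j → evalT v (block i s j) ≡ evalT v (block i zero j)) → blockVal xs i s ≡ blockVal xs i zero
      disagree a = trans (to (blocks-agree i s (block i zero)) a) (sym blockTerms)
      implies : T (evalC v (isFalse y ∷ isTrue y' ∷ [])) → T (evalL v (isTrue y)) → T (evalL v (isTrue y'))
      implies t ty = [ (λ f → ⊥-elim (T-not⁻ f ty)) , (λ r → to (single v (isTrue y')) r) ]
                       (to (T-∨ {evalL v (isFalse y)}) t)
      unimplies : (T (evalL v (isTrue y)) → T (evalL v (isTrue y'))) → T (evalC v (isFalse y ∷ isTrue y' ∷ []))
      unimplies f with T-or-not (evalL v (isTrue y))
      ... | inj₁ ty = from (T-∨ {evalL v (isFalse y)}) (inj₂ (from (single v (isTrue y')) (f ty)))
      ... | inj₂ fy = from (T-∨ {evalL v (isFalse y)}) (inj₁ fy)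

    liftAtom-val : ∀ rI → (∀ r u → rI (τrel r) u ≡ relI 𝔄 r u) → ∀ r ts →
                   evalA v (liftAtom r ts) ≡ Eψ.evalA rI (ψAsg xs) (rel (τrel r) ts)
    liftAtom-val rI onτ r ts = trans (cong (relI 𝔄 r) (liftTerms-val rI ts)) (sym (onτ r _))

    lift≟-val : ∀ rI t u → evalA v (liftTerm t ≐ liftTerm u) ≡ Eψ.evalA rI (ψAsg xs) (t ≐ u)
    lift≟-val rI t u = cong₂ (λ a b → ⌊ a ≟ b ⌋) (liftTerm-val rI t) (liftTerm-val rI u)

    plain-sem : ∀ rI → (∀ r u → rI (τrel r) u ≡ relI 𝔄 r u) → ∀ s l → PlainSLit l →
                T (evalC v (trLit s l)) ⇔ T (Eψ.evalL rI (ψAsg xs) l)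
    plain-sem rI onτ s l pl = mk⇔ (λ t → to ∨-false (subst T (lit-eq pl) t))
                                  (λ t → subst T (sym (lit-eq pl)) (from ∨-false t))
      where
      lit-eq : ∀ {l} → PlainSLit l → evalC v (trLit s l) ≡ (Eψ.evalL rI (ψAsg xs) l ∨ false)
      lit-eq (pτ r ts) = cong (_∨ false) (liftAtom-val rI onτ r ts)
      lit-eq (nτ r ts) = cong (λ b → not b ∨ false) (liftAtom-val rI onτ r ts)
      lit-eq (p≐ t u)  = cong (_∨ false) (lift≟-val rI t u)
      lit-eq (n≐ t u)  = cong (λ b → not b ∨ false) (lift≟-val rI t u)
      lit-eq p⊥ = refl
      lit-eq n⊥ = refl
      lit-eq p⊤ = refl
      lit-eq n⊤ = refl

    stripCl-val : ∀ rI → (∀ r u → rI (τrel r) u ≡ relI 𝔄 r u) → ∀ b →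
                  (∀ i u → rI (Psym i) u ≡ lookup b i) → (∀ u → rI Rsym u ≡ true) →
                  ∀ c → evalC v (L.map (stripLit b) c) ≡ Eψ.evalC rI (ψAsg xs) c
    stripCl-val rI onτ b onP onR []      = refl
    stripCl-val rI onτ b onP onR (l ∷ c) = cong₂ _∨_ (strip-eq l) (stripCl-val rI onτ b onP onR c)
      where
      ifPos : ∀ c → evalL v (if c then pos top else pos bot) ≡ c
      ifPos true  = refl
      ifPos false = refl
      ifNeg : ∀ c → evalL v (if c then pos bot else pos top) ≡ not c
      ifNeg true  = refl
      ifNeg false = refl
      strip-eq : ∀ l → evalL v (stripLit b l) ≡ Eψ.evalL rI (ψAsg xs) l
      strip-eq (pos (rel (τrel r) ts)) = liftAtom-val rI onτ r ts
      strip-eq (neg (rel (τrel r) ts)) = cong not (liftAtom-val rI onτ r ts)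
      strip-eq (pos (rel Rsym ts))     = sym (onR _)
      strip-eq (neg (rel Rsym ts))     = cong not (sym (onR _))
      strip-eq (pos (rel (Psym i) ts)) = trans (ifPos (lookup b i)) (sym (onP i _))
      strip-eq (neg (rel (Psym i) ts)) = trans (ifNeg (lookup b i)) (cong not (sym (onP i _)))
      strip-eq (pos (t ≐ u))           = lift≟-val rI t u
      strip-eq (neg (t ≐ u))           = cong not (lift≟-val rI t u)
      strip-eq (pos bot)               = refl
      strip-eq (neg bot)               = refl
      strip-eq (pos top)               = refl
      strip-eq (neg top)               = refl

  block-deps : ∀ xs z i s → L.map (lookup (xs ++ z)) (depsOf (truth i s)) ≡ L.tabulate (lookup (blockVal xs i s))
  block-deps xs z i s =
    trans (sym (ListP.map-∘ (L.allFin width)))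
          (trans (ListP.map-tabulate (λ j → j) (lookup (xs ++ z) ∘ (λ j → encU (arg i s j) ↑ˡ k)))
                 (ListP.tabulate-cong (λ j → trans (VecP.lookup-++ˡ xs z _) (sym (VecP.lookup∘tabulate _ j)))))

  deps-agree : ∀ {xs z xs' z'} i s →
               (L.map (lookup (xs ++ z)) (depsOf (truth i s)) ≡ L.map (lookup (xs' ++ z')) (depsOf (truth i s)))
               ⇔ (blockVal xs i s ≡ blockVal xs' i s)
  deps-agree {xs} {z} {xs'} {z'} i s = mk⇔
    (λ e → vec-ext (tabulate-injective width _ _ (trans (sym (block-deps xs z i s)) (trans e (block-deps xs' z' i s)))))
    (λ e → trans (block-deps xs z i s) (trans (cong (L.tabulate ∘ lookup) e) (sym (block-deps xs' z' i s))))

  nonzero-or-trivial : Σ A (λ a → ¬ a ≡ c0v) ⊎ (∀ a → a ≡ c0v)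
  nonzero-or-trivial with FinP.any? (λ a → ¬? (a ≟ c0v))
  ... | yes found = inj₁ found
  ... | no none   = inj₂ (λ a → decidable-stable (a ≟ c0v) (λ a≢0 → none (a , a≢0)))

  trivial-vecs : (∀ a → a ≡ c0v) → ∀ {n} (u w : Vec A n) → u ≡ w
  trivial-vecs all0 u w = vec-ext (λ j → trans (all0 _) (sym (all0 _)))

  Model : Team (size 𝔄) k → Set
  Model X = Σ Preds λ Ps → ∀ rI → Expands rI X Ps → Satisfies rI

  ⊨SO⇒ : ∀ {X} → 𝔄 , X ⊨SO ψ → Σ Preds λ Ps → Σ SymInterp λ rI → Expands rI X Ps × Satisfies rI
  ⊨SO⇒ (Ps , sat) = Ps , _ , record { onτ = λ _ _ → refl ; onR = λ _ → refl ; onP = λ _ _ → refl } , sat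

  Model⇒⊨SO : ∀ {X} → Model X → 𝔄 , X ⊨SO ψ
  Model⇒⊨SO (Ps , sat) = Ps , sat _ (record { onτ = λ _ _ → refl ; onR = λ _ → refl ; onP = λ _ _ → refl })

  open SkolemForm 𝔄 φ using (asg)

  Holds : Team (size 𝔄) k → (Vec A nOuter → Vec A nEx) → List Lit → Set
  Holds X G ls = ∀ xs z → T (X z) → T (evalC (asg G xs z) ls)

  record ClauseGroups (X : Team (size 𝔄) k) (G : Vec A nOuter → Vec A nEx) : Set where
    field
      oneElem : ∀ fs → Holds X G (oneElemCl fs)
      down    : ∀ i s → Holds X G (consDown i s)
      up      : ∀ i s → Holds X G (consUp i s)
      forR    : Holds X G RCl
      guarded : All (λ c → Holds X G (guardedCl c)) cs

  groups⇔ : ∀ X G → ClauseGroups X G ⇔ All (λ C → Holds X G (BD.BDClause.lits C)) allCls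
  groups⇔ X G = mk⇔ forth back
    where
    H : BD.BDClause τ nEx nOuter → Set
    H C = Holds X G (BD.BDClause.lits C)

    perBlock⇔ : ∀ f wf → (∀ i s → Holds X G (f i s)) ⇔ All H (perBlock f wf)
    perBlock⇔ f wf = mk⇔
      (λ h → AllP.concat⁺ (AllP.map⁺ {f = row} (AllP.tabulate⁺ {f = λ x → x}
               (λ i → AllP.map⁺ {f = cl i} (AllP.tabulate⁺ {f = λ x → x} (λ s → h i s))))))
      (λ h i s → AllP.tabulate⁻ {f = λ x → x} (AllP.map⁻ {f = cl i}
                   (AllP.tabulate⁻ {f = λ x → x} (AllP.map⁻ {f = row} (AllP.concat⁻ h)) i)) s)
      where
      cl : Fin NP → Fin nSlots → BD.BDClause τ nEx nOuter
      cl i s = mkClause (f i s) (wf i s)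
      row : Fin NP → List (BD.BDClause τ nEx nOuter)
      row i = L.map (cl i) (L.allFin nSlots)

    guarded⇔ : ∀ xs hs → All (λ c → Holds X G (guardedCl c)) xs ⇔ All H (guardedCls xs hs)
    guarded⇔ []       []       = mk⇔ (λ _ → []) (λ _ → [])
    guarded⇔ (c ∷ xs) (h ∷ hs) = mk⇔ (λ { (o ∷ os) → o ∷ to (guarded⇔ xs hs) os })
                                     (λ { (o ∷ os) → o ∷ from (guarded⇔ xs hs) os })

    forth : ClauseGroups X G → All H allCls
    forth g = AllP.++⁺ (AllP.map⁺ (All.universal oneElem _))
             (AllP.++⁺ (to (perBlock⇔ consDown consDown-wf) down)
             (AllP.++⁺ (to (perBlock⇔ consUp consUp-wf) up)
                       (forR ∷ to (guarded⇔ cs hornψ) guarded)))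
      where open ClauseGroups g

    back : All H allCls → ClauseGroups X G
    back h = record
      { oneElem = λ fs → All.lookup (AllP.map⁻ h₁) (allVecs-complete _ _ fs (λ j → ∈-allFin _))
      ; down    = from (perBlock⇔ consDown consDown-wf) h₂
      ; up      = from (perBlock⇔ consUp consUp-wf) h₃
      ; forR    = All.head h₄
      ; guarded = from (guarded⇔ cs hornψ) (All.tail h₄) }
      where
      h₁ : All H oneElemCls
      h₁ = AllP.++⁻ˡ oneElemCls h
      h₂ : All H (perBlock consDown consDown-wf)
      h₂ = AllP.++⁻ˡ (perBlock consDown consDown-wf) (AllP.++⁻ʳ oneElemCls h)
      h₃ : All H (perBlock consUp consUp-wf)
      h₃ = AllP.++⁻ˡ (perBlock consUp consUp-wf) (AllP.++⁻ʳ (perBlock consDown consDown-wf) (AllP.++⁻ʳ oneElemCls h))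
      h₄ : All H (mkClause RCl RCl-wf ∷ guardedCls cs hornψ)
      h₄ = AllP.++⁻ʳ (perBlock consUp consUp-wf) (AllP.++⁻ʳ (perBlock consDown consDown-wf) (AllP.++⁻ʳ oneElemCls h))

-- Section 4.  From a model of ψ to Skolem functions for φ
--
-- Given R = X and predicates Ps, the truth variable of a block codes,
-- by 0 and d, whether the block (unpadded) is in the relation; the flag
-- is d.  For d ≠ 0 this satisfies every clause; in a one-element
-- structure, where necessarily d = 0, the guards hold trivially and the
-- one-element clauses hold by the valuation read off from Ps.

module Backward (τ : Vocabulary) (k : ℕ) (ψ : SOHorn τ k) (𝔄 : Structure τ)
                (X : Team (size 𝔄) k) (Ps : (i : Fin (SOHorn.mP ψ)) → Vec (Fin (size 𝔄)) (SOHorn.ars ψ i) → Bool)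
                (d : Fin (size 𝔄)) where
  open SOHorn ψ renaming (p to pψ; clauses to cs) hiding (horn)
  open Translation τ k ψ
  open Evaluation τ k ψ 𝔄
  open SkolemForm 𝔄 φ using (Skolem; Functional; asg)
  open TeamSem 𝔄 using (A)
  open Eval {Const τ} {Rel τ} {arity τ} {size 𝔄} (constI 𝔄) (relI 𝔄)

  code : Bool → A
  code b = if b then c0v else d

  code-true : ∀ {b} → T b → code b ≡ c0v
  code-true {true} _ = refl

  code-false : ∀ {b} → T (not b) → code b ≡ d
  code-false {false} _ = refl

  relAt : (i : Fin NP) → Vec A (arityOf i) → Bool
  relAt zero    = X
  relAt (suc i) = Ps i

  codeOf : Fin NP → Vec A width → A
  codeOf i u = code (relAt i (unpad (arityOf i) u))

  yval : EVar → Vec A nUniv → A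
  yval flag        xs = d
  yval (truth i s) xs = codeOf i (blockVal xs i s)

  yvals : Vec A nOuter → Fin nEx → A
  yvals w y = yval (decY y) (V.take nUniv w)

  G : Vec A nOuter → Vec A nEx
  G w = tabulate (yvals w)

  G-lookup : ∀ xs z y → lookup (G (xs ++ z)) y ≡ yval (decY y) xs
  G-lookup xs z y = trans (VecP.lookup∘tabulate (yvals (xs ++ z)) y) (cong (yval (decY y)) (take-++ xs z))

  G-val : ∀ xs z y → lookup (G (xs ++ z)) (encY y) ≡ yval y xs
  G-val xs z y = trans (G-lookup xs z (encY y)) (cong (λ e → yval e xs) (decY-encY y))

  truth-val : ∀ xs z i s {tv} → blockVal xs i s ≡ pad width tv →
              lookup (G (xs ++ z)) (encY (truth i s)) ≡ code (relAt i tv)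
  truth-val xs z i s {tv} e =
    trans (G-val xs z (truth i s)) (trans (cong (codeOf i) e) unpadded)
    where
    unpadded : codeOf i (pad width tv) ≡ code (relAt i tv)
    unpadded = cong (λ u → code (relAt i u)) (unpad-pad width tv (arity≤width i))

  G-functional : ∀ y → Functional X G y
  G-functional y {xs} {z} {xs'} {z'} _ _ agree =
    trans (G-lookup xs z y) (trans (same (decY y) agree) (sym (G-lookup xs' z' y)))
    where
    same : ∀ e → L.map (lookup (xs ++ z)) (depsOf e) ≡ L.map (lookup (xs' ++ z')) (depsOf e) → yval e xs ≡ yval e xs'
    same flag        _ = refl
    same (truth i s) a = cong (codeOf i) (to (deps-agree {xs} {z} {xs'} {z'} i s) a)

  cons-holds : ∀ i s → Holds X G (consDown i s) × Holds X G (consUp i s)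
  cons-holds i s =
    (λ xs z _ → from (cons-sem (G (xs ++ z)) xs z i s (truth i s) (truth i zero)) (λ e y0 → trans (sym (same xs z e)) y0)) ,
    (λ xs z _ → from (cons-sem (G (xs ++ z)) xs z i s (truth i zero) (truth i s)) (λ e y0 → trans (same xs z e) y0))
    where
    same : ∀ xs z → blockVal xs i s ≡ blockVal xs i zero →
           lookup (G (xs ++ z)) (encY (truth i s)) ≡ lookup (G (xs ++ z)) (encY (truth i zero))
    same xs z e = trans (G-val xs z (truth i s))
                        (trans (cong (codeOf i) e) (sym (G-val xs z (truth i zero))))

  R-holds : Holds X G RCl
  R-holds xs z x = from (unlessBlock-sem (G (xs ++ z)) xs z zero zero _ (isTrue (truth zero zero))) λ e →
    from (isTrue-sem (G (xs ++ z)) xs z (truth zero zero))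
      (trans (truth-val xs z zero zero
               (trans e (zblock-val (G (xs ++ z)) xs z)))
             (code-true x))

  skolem : (∀ fs → Holds X G (oneElemCl fs)) → All (λ c → Holds X G (guardedCl c)) cs → Skolem X G
  skolem oneElem guarded = record
    { functional = G-functional
    ; satisfies  = to (groups⇔ X G) (record
        { oneElem = oneElem
        ; down    = λ i s → proj₁ (cons-holds i s)
        ; up      = λ i s → proj₂ (cons-holds i s)
        ; forR    = R-holds
        ; guarded = guarded }) }

  module Large (d≢0 : ¬ d ≡ c0v) (rI : SymInterp) (ex : Expands rI X Ps) (sat : Satisfies rI)
               (negR : OnlyNegR ψ) where
    open Expands ex

    atom-truth : ∀ xs z i s (ts : Vec (Term (Const τ) pψ) (arityOf i)) →
                 blockVal xs i s ≡ V.map (evalT (asg G xs z)) (argBlock ts) →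
                 lookup (G (xs ++ z)) (encY (truth i s)) ≡ code (relAt i (V.map (Eψ.evalT rI (ψAsg xs)) ts))
    atom-truth xs z i s ts e = truth-val xs z i s (trans e (argBlock-val (G (xs ++ z)) xs z rI ts))

    false-atom : ∀ xs z i s (ts : Vec (Term (Const τ) pψ) (arityOf i)) →
                 T (not (relAt i (V.map (Eψ.evalT rI (ψAsg xs)) ts))) →
                 T (evalC (asg G xs z) (unlessBlock i s (argBlock ts) (isFalse (truth i s))))
    false-atom xs z i s ts f = from (unlessBlock-sem (G (xs ++ z)) xs z i s _ _) λ e →
      from (isFalse-sem (G (xs ++ z)) xs z (truth i s)) λ y0 →
        d≢0 (trans (sym (trans (atom-truth xs z i s ts e) (code-false f))) y0)

    trLit-holds : ∀ xs z s l → (∀ ts → ¬ l ≡ pos (rel Rsym ts)) → T (Eψ.evalL rI (ψAsg xs) l) →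
                  T (evalC (asg G xs z) (trLit s l))
    trLit-holds xs z s (pos (rel Rsym ts))     notR _ = ⊥-elim (notR ts refl)
    trLit-holds xs z s (neg (rel Rsym ts))     _    t = false-atom xs z zero s ts (subst (T ∘ not) (onR _) t)
    trLit-holds xs z s (neg (rel (Psym i) ts)) _    t = false-atom xs z (suc i) s ts (subst (T ∘ not) (onP i _) t)
    trLit-holds xs z s (pos (rel (Psym i) ts)) _    t =
      from (unlessBlock-sem (G (xs ++ z)) xs z (suc i) s _ _) λ e →
        from (isTrue-sem (G (xs ++ z)) xs z (truth (suc i) s))
          (trans (atom-truth xs z (suc i) s ts e) (code-true (subst T (onP i _) t)))
    trLit-holds xs z s (pos (rel (τrel r) ts)) _ t = from (plain-sem (G (xs ++ z)) xs z rI onτ s _ (pτ r ts)) t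
    trLit-holds xs z s (neg (rel (τrel r) ts)) _ t = from (plain-sem (G (xs ++ z)) xs z rI onτ s _ (nτ r ts)) t
    trLit-holds xs z s (pos (t ≐ u))           _ h = from (plain-sem (G (xs ++ z)) xs z rI onτ s _ (p≐ t u)) h
    trLit-holds xs z s (neg (t ≐ u))           _ h = from (plain-sem (G (xs ++ z)) xs z rI onτ s _ (n≐ t u)) h
    trLit-holds xs z s (pos bot)               _ h = from (plain-sem (G (xs ++ z)) xs z rI onτ s _ p⊥) h
    trLit-holds xs z s (neg bot)               _ h = from (plain-sem (G (xs ++ z)) xs z rI onτ s _ n⊥) h
    trLit-holds xs z s (pos top)               _ h = from (plain-sem (G (xs ++ z)) xs z rI onτ s _ p⊤) h
    trLit-holds xs z s (neg top)               _ h = from (plain-sem (G (xs ++ z)) xs z rI onτ s _ n⊤) h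

    trCl-holds : ∀ xs z n c → All (λ l → ∀ ts → ¬ l ≡ pos (rel Rsym ts)) c → T (Eψ.evalC rI (ψAsg xs) c) →
                 T (evalC (asg G xs z) (trCl n c))
    trCl-holds xs z n (l ∷ c) (notR ∷ notRs) h =
      from (evalC-++ (asg G xs z) (trLit (slotOf n) l) (trCl (suc n) c))
        ([ (λ hl → inj₁ (trLit-holds xs z (slotOf n) l notR hl)) ,
           (λ hc → inj₂ (trCl-holds xs z (suc n) c notRs hc)) ] (to (T-∨ {Eψ.evalL rI (ψAsg xs) l}) h))

    skolem-large : Skolem X G
    skolem-large = skolem oneElem-holds guarded-holds
      where
      oneElem-holds : ∀ fs → Holds X G (oneElemCl fs)
      oneElem-holds fs xs z _ = from (T-∨ {evalL (asg G xs z) (isFalse flag)})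
        (inj₁ (from (isFalse-sem (G (xs ++ z)) xs z flag) (λ e → d≢0 (trans (sym (G-val xs z flag)) e))))
      guarded-holds : All (λ c → Holds X G (guardedCl c)) cs
      guarded-holds = All.zipWith
        (λ { {c} (h , notR) xs z _ → from (T-∨ {evalL (asg G xs z) (pos (uvar g₁ ≐ uvar g₂))})
                                          (inj₂ (trCl-holds xs z 0 c notR (h (ψAsg xs)))) })
        (All-swap cs sat , negR)

  module OneElement (all0 : ∀ a → a ≡ c0v) {s₀} (x₀ : T (X s₀)) (rI : SymInterp) (ex : Expands rI X Ps)
                    (sat : Satisfies rI) where
    open Expands ex

    b* : Vec Bool mP
    b* = tabulate (λ i → Ps i (replicate _ c0v))

    onP* : ∀ i u → rI (Psym i) u ≡ lookup b* i
    onP* i u = trans (onP i u) (trans (cong (Ps i) (trivial-vecs all0 u _)) (sym (VecP.lookup∘tabulate _ i)))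

    onR* : ∀ u → rI Rsym u ≡ true
    onR* u = trans (onR u) (trans (cong X (trivial-vecs all0 u s₀)) (to T-≡ x₀))

    b*∈valuations : b* ∈ valuations
    b*∈valuations = allVecs-complete _ mP b* (λ j → bool∈ (lookup b* j))
      where
      bool∈ : ∀ b → b ∈ (true ∷ false ∷ [])
      bool∈ true  = AnyL.here refl
      bool∈ false = AnyL.there (AnyL.here refl)

    choiceDisj-holds : ∀ (v : Vec A (nEx + nOuter)) bs fs → b* ∈ bs →
                       (∀ f → T (Eval.evalC (constI 𝔄) (relI 𝔄) v (L.map (stripLit b*) (L.lookup cs f)))) →
                       T (Eval.evalC (constI 𝔄) (relI 𝔄) v (choiceDisj bs fs))
    choiceDisj-holds v (b ∷ bs) (f ∷ fs) (AnyL.here refl) h =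
      from (evalC-++ v (L.map (stripLit b) (L.lookup cs f)) (choiceDisj bs fs)) (inj₁ (h f))
    choiceDisj-holds v (b ∷ bs) (f ∷ fs) (AnyL.there b*∈) h =
      from (evalC-++ v (L.map (stripLit b) (L.lookup cs f)) (choiceDisj bs fs)) (inj₂ (choiceDisj-holds v bs fs b*∈ h))

    skolem-one : Skolem X G
    skolem-one = skolem oneElem-holds (All.universal (λ c → guard-holds {c}) cs)
      where
      oneElem-holds : ∀ fs → Holds X G (oneElemCl fs)
      oneElem-holds fs xs z _ = from (T-∨ {evalL (asg G xs z) (isFalse flag)}) (inj₂
        (choiceDisj-holds (asg G xs z) valuations fs b*∈valuations λ f →
          subst T (sym (stripCl-val (G (xs ++ z)) xs z rI onτ b* onP* onR* (L.lookup cs f)))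
                (All-lookup (sat (ψAsg xs)) f)))
      guard-holds : ∀ {c} → Holds X G (guardedCl c)
      guard-holds {c} xs z _ = from (T-∨ {evalL (asg G xs z) (pos (uvar g₁ ≐ uvar g₂))})
        (inj₁ (fromWitness (trans (all0 _) (sym (all0 _)))))

-- Section 5.  From Skolem functions for φ to a model of ψ
--
-- Read the truth variables at canonical assignments (every block holding
-- the same tuple a, z̄ = s₀): by functionality they give the value at every
-- assignment of the team, by the consistency clauses all slots agree on
-- whether it is 0, and by the R-clause every member of X is coded as true.
-- With two elements, testing each clause of ψ at an assignment whose
-- guards differ yields ψ for Pᵢ = "coded as 0 at slot 0"; R is then X,
-- since a negated R-atom is only made true by a code ≠ 0.  With one
-- element, the one-element clauses yield a satisfying valuation.

module Forward (τ : Vocabulary) (k : ℕ) (ψ : SOHorn τ k) (𝔄 : Structure τ)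
               (X : Team (size 𝔄) k) {s₀ : Vec (Fin (size 𝔄)) k} (x₀ : T (X s₀))
               (G : Vec (Fin (size 𝔄)) (Translation.nOuter τ k ψ) → Vec (Fin (size 𝔄)) (Translation.nEx τ k ψ))
               (sk : SkolemForm.Skolem 𝔄 (Translation.φ τ k ψ) X G) where
  open SOHorn ψ renaming (p to pψ; clauses to cs) hiding (horn)
  open Translation τ k ψ
  open Evaluation τ k ψ 𝔄
  open SkolemForm 𝔄 φ using (Skolem; asg)
  open TeamSem 𝔄 using (A)
  open Eval {Const τ} {Rel τ} {arity τ} {size 𝔄} (constI 𝔄) (relI 𝔄)
  open Skolem sk
  open ClauseGroups (from (groups⇔ X G) satisfies)

  canonVal : Vec A width → UVar → A
  canonVal a (arg _ _ j) = lookup a j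
  canonVal a _           = c0v

  canon : Vec A width → Vec A nUniv
  canon a = mkUniv (canonVal a)

  canon-block : ∀ a i s → blockVal (canon a) i s ≡ a
  canon-block a i s = vec-ext (λ j → trans (VecP.lookup∘tabulate _ j) (mkUniv-lookup (canonVal a) (arg i s j)))

  coded : Fin NP → Fin nSlots → Vec A width → A
  coded i s a = lookup (G (canon a ++ s₀)) (encY (truth i s))

  truth-at : ∀ xs {z} → T (X z) → ∀ i s → lookup (G (xs ++ z)) (encY (truth i s)) ≡ coded i s (blockVal xs i s)
  truth-at xs {z} x i s = functional (encY (truth i s)) x x₀ agree
    where
    agree : L.map (lookup (xs ++ z)) (depsOf (decY (encY (truth i s)))) ≡
            L.map (lookup (canon (blockVal xs i s) ++ s₀)) (depsOf (decY (encY (truth i s))))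
    agree = subst (λ e → L.map (lookup (xs ++ z)) (depsOf e) ≡ L.map (lookup (canon (blockVal xs i s) ++ s₀)) (depsOf e))
                  (sym (decY-encY (truth i s)))
                  (from (deps-agree {xs} {z} {canon (blockVal xs i s)} {s₀} i s) (sym (canon-block _ i s)))

  coded-down : ∀ i s a → coded i s a ≡ c0v → coded i zero a ≡ c0v
  coded-down i s a = to (cons-sem (G (canon a ++ s₀)) (canon a) s₀ i s (truth i s) (truth i zero)) (down i s (canon a) s₀ x₀)
                       (trans (canon-block a i s) (sym (canon-block a i zero)))

  coded-up : ∀ i s a → coded i zero a ≡ c0v → coded i s a ≡ c0v
  coded-up i s a = to (cons-sem (G (canon a ++ s₀)) (canon a) s₀ i s (truth i zero) (truth i s)) (up i s (canon a) s₀ x₀)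
                     (trans (canon-block a i s) (sym (canon-block a i zero)))

  coded-R : ∀ {z} → T (X z) → coded zero zero (pad width z) ≡ c0v
  coded-R {z} x = trans (sym (trans (truth-at xs x zero zero) (cong (coded zero zero) (canon-block _ zero zero))))
                       (to (isTrue-sem (G (xs ++ z)) xs z (truth zero zero))
                           (to (unlessBlock-sem (G (xs ++ z)) xs z zero zero _ _) (forR xs z x)
                               (trans (canon-block _ zero zero)
                                      (sym (zblock-val (G (xs ++ z)) xs z)))))
    where
    xs : Vec A nUniv
    xs = canon (pad width z)

  module Large (nz : A) (nz≢0 : ¬ nz ≡ c0v) where
    Ps : Preds
    Ps i tv = ⌊ coded (suc i) zero (pad width tv) ≟ c0v ⌋

    module _ (rI : SymInterp) (ex : Expands rI X Ps) where
      open Expands ex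

      argsOf : Vec A pψ → SLit → Vec A width
      argsOf xp (pos (rel Rsym ts))     = pad width (V.map (Eψ.evalT rI xp) ts)
      argsOf xp (neg (rel Rsym ts))     = pad width (V.map (Eψ.evalT rI xp) ts)
      argsOf xp (pos (rel (Psym i) ts)) = pad width (V.map (Eψ.evalT rI xp) ts)
      argsOf xp (neg (rel (Psym i) ts)) = pad width (V.map (Eψ.evalT rI xp) ts)
      argsOf xp _                       = replicate width c0v

      atom-code : ∀ xs {z} → T (X z) → ∀ i s (ts : Vec (Term (Const τ) pψ) (arityOf i)) → ∀ l →
                  blockVal xs i s ≡ pad width (V.map (Eψ.evalT rI (ψAsg xs)) ts) →
                  T (evalC (asg G xs z) (unlessBlock i s (argBlock ts) l)) →
                  T (evalL (asg G xs z) l) × lookup (G (xs ++ z)) (encY (truth i s)) ≡ coded i s (pad width (V.map (Eψ.evalT rI (ψAsg xs)) ts))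
      atom-code xs {z} x i s ts l e h =
        to (unlessBlock-sem (G (xs ++ z)) xs z i s (argBlock ts) l) h (trans e (sym (argBlock-val (G (xs ++ z)) xs z rI ts))) ,
        trans (truth-at xs x i s) (cong (coded i s) e)

      trLit-sound : ∀ xs {z} → T (X z) → ∀ s l → (∀ i → blockVal xs i s ≡ argsOf (ψAsg xs) l) →
                    T (evalC (asg G xs z) (trLit s l)) → T (Eψ.evalL rI (ψAsg xs) l)
      trLit-sound xs x s (pos (rel Rsym ts)) e h = ⊥-elim (to ∨-false h)
      trLit-sound xs {z} x s (neg (rel Rsym ts)) e h with atom-code xs x zero s ts _ (e zero) h
      ... | f , y = subst (T ∘ not) (sym (onR _)) (T-not λ xt →
                      to (isFalse-sem (G (xs ++ z)) xs z (truth zero s)) f (trans y (coded-up zero s _ (coded-R xt))))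
      trLit-sound xs {z} x s (pos (rel (Psym i) ts)) e h with atom-code xs x (suc i) s ts _ (e (suc i)) h
      ... | t , y = subst T (sym (onP i _)) (fromWitness (coded-down (suc i) s _
                      (trans (sym y) (to (isTrue-sem (G (xs ++ z)) xs z (truth (suc i) s)) t))))
      trLit-sound xs {z} x s (neg (rel (Psym i) ts)) e h with atom-code xs x (suc i) s ts _ (e (suc i)) h
      ... | f , y = subst (T ∘ not) (sym (onP i _)) (T-not λ pt →
                      to (isFalse-sem (G (xs ++ z)) xs z (truth (suc i) s)) f (trans y (coded-up (suc i) s _ (toWitness pt))))
      trLit-sound xs {z} x s (pos (rel (τrel r) ts)) _ h = to (plain-sem (G (xs ++ z)) xs z rI onτ s _ (pτ r ts)) h
      trLit-sound xs {z} x s (neg (rel (τrel r) ts)) _ h = to (plain-sem (G (xs ++ z)) xs z rI onτ s _ (nτ r ts)) h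
      trLit-sound xs {z} x s (pos (t ≐ u))           _ h = to (plain-sem (G (xs ++ z)) xs z rI onτ s _ (p≐ t u)) h
      trLit-sound xs {z} x s (neg (t ≐ u))           _ h = to (plain-sem (G (xs ++ z)) xs z rI onτ s _ (n≐ t u)) h
      trLit-sound xs {z} x s (pos bot)               _ h = to (plain-sem (G (xs ++ z)) xs z rI onτ s _ p⊥) h
      trLit-sound xs {z} x s (neg bot)               _ h = to (plain-sem (G (xs ++ z)) xs z rI onτ s _ n⊥) h
      trLit-sound xs {z} x s (pos top)               _ h = to (plain-sem (G (xs ++ z)) xs z rI onτ s _ p⊤) h
      trLit-sound xs {z} x s (neg top)               _ h = to (plain-sem (G (xs ++ z)) xs z rI onτ s _ n⊤) h

      Prepared : Vec A nUniv → ℕ → List SLit → Set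
      Prepared xs n []      = ⊤
      Prepared xs n (l ∷ c) = (∀ i → blockVal xs i (slotOf n) ≡ argsOf (ψAsg xs) l) × Prepared xs (suc n) c

      trCl-sound : ∀ xs {z} → T (X z) → ∀ n c → Prepared xs n c →
                   T (evalC (asg G xs z) (trCl n c)) → T (Eψ.evalC rI (ψAsg xs) c)
      trCl-sound xs {z} x n (l ∷ c) (e , pc) h =
        from (T-∨ {Eψ.evalL rI (ψAsg xs) l})
          ([ (λ hl → inj₁ (trLit-sound xs x (slotOf n) l e hl)) , (λ hc → inj₂ (trCl-sound xs x (suc n) c pc hc)) ]
           (to (evalC-++ (asg G xs z) (trLit (slotOf n) l) (trCl (suc n) c)) h))

      nth : List SLit → ℕ → SLit
      nth []      _       = pos top
      nth (l ∷ c) zero    = l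
      nth (l ∷ c) (suc m) = nth c m

      testVal : Vec A pψ → List SLit → UVar → A
      testVal xp c (ψvar x)          = lookup xp x
      testVal xp c g₁                = c0v
      testVal xp c g₂                = nz
      testVal xp c (arg i zero j)    = c0v
      testVal xp c (arg i (suc s) j) = lookup (argsOf xp (nth c (toℕ s))) j

      testAsg : Vec A pψ → List SLit → Vec A nUniv
      testAsg xp c = mkUniv (testVal xp c)

      testAsg-ψ : ∀ xp c → ψAsg (testAsg xp c) ≡ xp
      testAsg-ψ xp c = vec-ext (λ x → trans (VecP.lookup∘tabulate _ x) (mkUniv-lookup (testVal xp c) (ψvar x)))

      testAsg-prepared : ∀ xp c n c' → (∀ m → nth c (n + m) ≡ nth c' m) → n + length c' ≤ nLits →
                         Prepared (testAsg xp c) n c'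
      testAsg-prepared xp c n []       _ _  = tt
      testAsg-prepared xp c n (l ∷ c') h le =
        holds-args , testAsg-prepared xp c (suc n) c' (λ m → trans (cong (nth c) (sym (+-suc n m))) (h (suc m)))
                                                  (subst (_≤ nLits) (+-suc n (length c')) le)
        where
        open ≡-Reasoning
        holds-args : ∀ i → blockVal (testAsg xp c) i (slotOf n) ≡ argsOf (ψAsg (testAsg xp c)) l
        holds-args i = begin
          blockVal (testAsg xp c) i (slotOf n)          ≡⟨ VecP.tabulate-cong (λ j → mkUniv-lookup (testVal xp c) (arg i (slotOf n) j)) ⟩
          tabulate (lookup (argsOf xp (nth c (toℕ (clamp nLits n)))))
                                                        ≡⟨ VecP.tabulate∘lookup _ ⟩
          argsOf xp (nth c (toℕ (clamp nLits n)))      ≡⟨ cong (λ m → argsOf xp (nth c m)) (clamp-toℕ nLits n (m+n≤o⇒m≤o n le)) ⟩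
          argsOf xp (nth c n)                           ≡⟨ cong (λ m → argsOf xp (nth c m)) (sym (+-identityʳ n)) ⟩
          argsOf xp (nth c (n + 0))                     ≡⟨ cong (argsOf xp) (h 0) ⟩
          argsOf xp l                                   ≡⟨ cong (λ q → argsOf q l) (sym (testAsg-ψ xp c)) ⟩
          argsOf (ψAsg (testAsg xp c)) l                ∎

      testAsg-val : ∀ xp c u → evalT (asg G (testAsg xp c) s₀) (uvar u) ≡ testVal xp c u
      testAsg-val xp c u = trans (uvar-val (G (testAsg xp c ++ s₀)) (testAsg xp c) s₀ u) (mkUniv-lookup (testVal xp c) u)

      -- the guard fails at the test assignment, so the translated clause holds
      clause-sound : ∀ xp c → length c ≤ nLits → Holds X G (guardedCl c) → T (Eψ.evalC rI xp c)
      clause-sound xp c le h with to (T-∨ {evalL (asg G (testAsg xp c) s₀) (pos (uvar g₁ ≐ uvar g₂))}) (h (testAsg xp c) s₀ x₀)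
      ... | inj₁ guard = ⊥-elim (nz≢0 (trans (sym (testAsg-val xp c g₂)) (trans (sym (toWitness guard)) (testAsg-val xp c g₁))))
      ... | inj₂ t     = subst (λ q → T (Eψ.evalC rI q c)) (testAsg-ψ xp c)
                           (trCl-sound (testAsg xp c) x₀ 0 c (testAsg-prepared xp c 0 c (λ m → refl) le) t)

      satisfies-ψ : Satisfies rI
      satisfies-ψ xp = All.zipWith (λ { {c} (h , le) → clause-sound xp c le h }) (guarded , length≤nLits)

    model-large : Model X
    model-large = Ps , satisfies-ψ

  -- One-element structures: the flag is 0, so every choice of one clause
  -- per valuation is made true by some valuation; hence some valuation
  -- makes all clauses true.
  module OneElement (all0 : ∀ a → a ≡ c0v) where
    xs₀ : Vec A nUniv
    xs₀ = replicate nUniv c0v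

    v₀ : Vec A (nEx + nOuter)
    v₀ = asg G xs₀ s₀

    choices-hold : ∀ fs → T (evalC v₀ (choiceDisj valuations fs))
    choices-hold fs with to (T-∨ {evalL v₀ (isFalse flag)}) (oneElem fs xs₀ s₀ x₀)
    ... | inj₁ f = ⊥-elim (to (isFalse-sem (G (xs₀ ++ s₀)) xs₀ s₀ flag) f (all0 _))
    ... | inj₂ t = t

    Good : Vec Bool mP → Set
    Good b = All (λ c → T (evalC v₀ (L.map (stripLit b) c))) cs

    search : ∀ bs → Σ (Vec Bool mP) Good ⊎ Σ (Vec (Fin nCls) (length bs)) (λ fs → ¬ T (evalC v₀ (choiceDisj bs fs)))
    search []       = inj₂ ([] , λ ())
    search (b ∷ bs) with All.all? (λ c → T? (evalC v₀ (L.map (stripLit b) c))) cs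
    ... | yes good = inj₁ (b , good)
    ... | no bad with search bs
    ...   | inj₁ found     = inj₁ found
    ...   | inj₂ (fs , nf) = inj₂ (AnyL.index falsified ∷ fs , λ t →
              [ AnyP.lookup-index falsified , nf ] (to (evalC-++ v₀ (L.map (stripLit b) (L.lookup cs (AnyL.index falsified))) _) t))
      where
      falsified : AnyL.Any (λ c → ¬ T (evalC v₀ (L.map (stripLit b) c))) cs
      falsified = AllP.¬All⇒Any¬ (λ c → T? (evalC v₀ (L.map (stripLit b) c))) cs bad

    good-valuation : Σ (Vec Bool mP) Good
    good-valuation with search valuations
    ... | inj₁ found     = found
    ... | inj₂ (fs , nf) = ⊥-elim (nf (choices-hold fs))

    model-one : Model X
    model-one = let b , good = good-valuation in (λ i _ → lookup b i) , λ rI ex xp →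
      All.map (λ {c} h → subst (λ q → T (Eψ.evalC rI q c)) (trivial-vecs all0 _ xp)
                           (subst T (stripCl-val (G (xs₀ ++ s₀)) xs₀ s₀ rI (onτ ex) b (onP ex)
                                                 (λ u → trans (onR ex u) (trans (cong X (trivial-vecs all0 u s₀)) (to T-≡ x₀))) c) h))
              good
      where open Expands

theorem5p5 : (τ : Vocabulary) (k : ℕ) (ψ : SOHorn τ k) → OnlyNegR ψ →
    Σ (BDHorn τ k) λ φ →
      ∀ (𝔄 : Structure τ) (X : Team (size 𝔄) k) →
        Σ (Vec (Fin (size 𝔄)) k) (λ s → T (X s)) →
        (TeamSem._⊨_ 𝔄 X (BDHorn.formula φ)) ⇔ (𝔄 , X ⊨SO ψ)
theorem5p5 τ k ψ negR = φ , correct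
  where
  open Translation τ k ψ using (φ)
  correct : ∀ (𝔄 : Structure τ) (X : Team (size 𝔄) k) → Σ (Vec (Fin (size 𝔄)) k) (λ s → T (X s)) →
            (TeamSem._⊨_ 𝔄 X (BDHorn.formula φ)) ⇔ (𝔄 , X ⊨SO ψ)
  correct 𝔄 X (_ , x₀) = mk⇔ forth back
    where
    open Evaluation τ k ψ 𝔄
    open SkolemForm 𝔄 φ using (bd-skolem)
    forth : TeamSem._⊨_ 𝔄 X (BDHorn.formula φ) → 𝔄 , X ⊨SO ψ
    forth h = let G , sk = to (bd-skolem X) h in Model⇒⊨SO
      ([ (λ (nz , nz≢0) → Forward.Large.model-large τ k ψ 𝔄 X x₀ G sk nz nz≢0)
       , Forward.OneElement.model-one τ k ψ 𝔄 X x₀ G sk ]′ nonzero-or-trivial)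
    back : 𝔄 , X ⊨SO ψ → TeamSem._⊨_ 𝔄 X (BDHorn.formula φ)
    back h = let Ps , rI , ex , sat = ⊨SO⇒ h in from (bd-skolem X)
      ([ (λ (nz , nz≢0) → _ , Backward.Large.skolem-large τ k ψ 𝔄 X Ps nz nz≢0 rI ex sat negR)
       , (λ all0 → _ , Backward.OneElement.skolem-one τ k ψ 𝔄 X Ps c0v all0 x₀ rI ex sat) ]′ nonzero-or-trivial)
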